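{- The category $\mathbf{uGraph}$ of finite undirected multigraphs, with $\mathcal{M}$ the class of component-wise monic morphisms, is a finitary $\mathcal{M}$-adhesive category with an $\mathcal{M}$-initial object, $\mathcal{M}$-effective unions and an epi-$\mathcal{M}$-factorization; moreover, final pullback complements along all composable pairs of $\mathcal{M}$-morphisms exist in $\mathbf{uGraph}$ and $\mathcal{M}$-morphisms are stable under final pullback complements. (That is, $\mathbf{uGraph}$ satisfies the standing assumptions both for Double-Pushout and for Sesqui-Pushout rewriting.)
   Context: Let $\mathcal{P}^{(1,2)}:\mathbf{Set}\to\mathbf{Set}$ be the restricted powerset functor sending a set $S$ to the set of its subsets $P\subseteq S$ with $1\le |P|\le 2$. The category $\mathbf{uGraph}$ is the restriction to finite sets of the comma category $(\mathrm{Id}_{\mathbf{Set}},\mathcal{P}^{(1,2)})$: an object is a triple $G=(E_G,V_G,i_G)$ of finite sets of edges and vertices and an incidence map $i_G:E_G\to\mathcal{P}^{(1,2)}(V_G)$; a morphism $G\to G'$ is a pair $(\varphi_E:E_G\to E_{G'},\varphi_V:V_G\to V_{G'})$ with $i_{G'}\circ\varphi_E=\mathcal{P}^{(1,2)}(\varphi_V)\circ i_G$. An $\mathcal{M}$-adhesive category $(\mathbf{C},\mathcal{M})$: $\mathcal{M}$ is a class of monomorphisms containing all isomorphisms and stable under composition, pushout and pullback; pushouts and pullbacks along $\mathcal{M}$-morphisms exist; pushouts along $\mathcal{M}$-morphisms are $\mathcal{M}$-van Kampen squares. Finitary: every object has only finitely many $\mathcal{M}$-subobjects up to isomorphism. $\mathcal{M}$-initial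 object $\varnothing$: for every object $X$ there is a unique $\mathcal{M}$-morphism $\varnothing\to X$. $\mathcal{M}$-effective unions: whenever a cospan $B\to D\leftarrow C$ of $\mathcal{M}$-morphisms is the pushout of a span $B\leftarrow A\to C$ of $\mathcal{M}$-morphisms and $B\to E\leftarrow C$ is a cospan of $\mathcal{M}$-morphisms whose pullback is $B\leftarrow A\to C$, the induced morphism $D\to E$ is in $\mathcal{M}$. Epi-$\mathcal{M}$-factorization: every morphism $f$ factors as $f=m\circ e$ with $m\in\mathcal{M}$ and $e$ an epimorphism, uniquely up to isomorphism. Final pullback complement (FPC) of a composable pair $a:A\to B$, $b:B\to D$: a pair $d:A\to C$, $c:C\to D$ such that $(a,d)$ is a pullback of $(b,c)$ and for every pullback $(a\circ p,q)$ of $(b,r)$ (with $q:X\to Y$, $r:Y\to D$, $p:X\to A$) there is a morphism $s:Y\to C$, unique up to isomorphism, with $r=c\circ s$ and $s\circ q=d\circ p$. $\mathcal{M}$ is stable under FPCs if the FPC of any composable pair of $\mathcal{M}$-morphisms (if it exists) consists of $\mathcal{M}$-morphisms. -}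

module Defs where

open import Data.Nat using (ℕ)
open import Data.Fin using (Fin)
open import Data.Product using (Σ; _×_; _,_; proj₁; proj₂)
open import Data.Sum using (_⊎_; inj₁; inj₂)
open import Relation.Binary.PropositionalEquality
  using (_≡_; refl; sym; trans; cong)
open import Relation.Binary.Structures using (IsEquivalence)
open import Function.Definitions using (Injective)

-- Categories (hom-setoids; morphism equality is a setoid relation since
-- we have no function extensionality)

record Category : Set₁ where
  infixr 9 _∘_
  infix 4 _≈_
  field
    Obj : Set
    Hom : Obj → Obj → Set
    _≈_ : ∀ {A B} → Hom A B → Hom A B → Set
    id  : ∀ {A} → Hom A A
    _∘_ : ∀ {A B C} → Hom B C → Hom A B → Hom A C
    ≈-equiv   : ∀ {A B} → IsEquivalence (_≈_ {A} {B})
    ∘-resp-≈  : ∀ {A B C} {f f′ : Hom B C} {g g′ : Hom A B} →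
                f ≈ f′ → g ≈ g′ → f ∘ g ≈ f′ ∘ g′
    identityˡ : ∀ {A B} {f : Hom A B} → id ∘ f ≈ f
    identityʳ : ∀ {A B} {f : Hom A B} → f ∘ id ≈ f
    assoc     : ∀ {A B C D} {f : Hom C D} {g : Hom B C} {h : Hom A B} →
                (f ∘ g) ∘ h ≈ f ∘ (g ∘ h)

module Notions (C : Category) (M : ∀ {A B} → Category.Hom C A B → Set) where
  open Category C

  Mono : ∀ {A B} → Hom A B → Set
  Mono {A} {B} f = ∀ {X} (g h : Hom X A) → f ∘ g ≈ f ∘ h → g ≈ h

  Epi : ∀ {A B} → Hom A B → Set
  Epi {A} {B} f = ∀ {X} (g h : Hom B X) → g ∘ f ≈ h ∘ f → g ≈ h

  IsIso : ∀ {A B} → Hom A B → Set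
  IsIso {A} {B} f = Σ (Hom B A) λ g → (g ∘ f ≈ id) × (f ∘ g ≈ id)

  record IsPullback {P A B Z : Obj} (p₁ : Hom P A) (p₂ : Hom P B)
                    (f : Hom A Z) (g : Hom B Z) : Set where
    field
      commutes  : f ∘ p₁ ≈ g ∘ p₂
      universal : ∀ {X} (h₁ : Hom X A) (h₂ : Hom X B) → f ∘ h₁ ≈ g ∘ h₂ →
                  Σ (Hom X P) λ u → (p₁ ∘ u ≈ h₁) × (p₂ ∘ u ≈ h₂) ×
                    (∀ (u′ : Hom X P) → p₁ ∘ u′ ≈ h₁ → p₂ ∘ u′ ≈ h₂ → u′ ≈ u)

  record IsPushout {Z A B Q : Obj} (f : Hom Z A) (g : Hom Z B)
                   (i₁ : Hom A Q) (i₂ : Hom B Q) : Set where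
    field
      commutes  : i₁ ∘ f ≈ i₂ ∘ g
      universal : ∀ {X} (h₁ : Hom A X) (h₂ : Hom B X) → h₁ ∘ f ≈ h₂ ∘ g →
                  Σ (Hom Q X) λ u → (u ∘ i₁ ≈ h₁) × (u ∘ i₂ ≈ h₂) ×
                    (∀ (u′ : Hom Q X) → u′ ∘ i₁ ≈ h₁ → u′ ∘ i₂ ≈ h₂ → u′ ≈ u)

  -- Bottom face: pushout square
  --   A --m--> B, A --f--> C, B --g--> D, C --n--> D.
  -- Top face A' B' C' D' with m', f', g', n'; vertical a, b, c, d.
  IsMVanKampen : ∀ {A B C D} (m : Hom A B) (f : Hom A C) (g : Hom B D) (n : Hom C D) → Set
  IsMVanKampen {A} {B} {C} {D} m f g n =
    ∀ {A′ B′ C′ D′}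
      (m′ : Hom A′ B′) (f′ : Hom A′ C′) (g′ : Hom B′ D′) (n′ : Hom C′ D′)
      (a : Hom A′ A) (b : Hom B′ B) (c : Hom C′ C) (d : Hom D′ D) →
    g′ ∘ m′ ≈ n′ ∘ f′ →
    m ∘ a ≈ b ∘ m′ → f ∘ a ≈ c ∘ f′ → g ∘ b ≈ d ∘ g′ → n ∘ c ≈ d ∘ n′ →
    M b → M c → M d →
    IsPullback m′ a b m → IsPullback f′ a c f →
    (IsPushout m′ f′ g′ n′ → IsPullback g′ b d g × IsPullback n′ c d n) ×
    (IsPullback g′ b d g × IsPullback n′ c d n → IsPushout m′ f′ g′ n′)

  record IsMAdhesive : Set where
    field
      M-mono      : ∀ {A B} (f : Hom A B) → M f → Mono f
      M-isos      : ∀ {A B} (f : Hom A B) → IsIso f → M f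
      M-comp      : ∀ {A B C′} (f : Hom A B) (g : Hom B C′) → M f → M g → M (g ∘ f)
      M-pushout   : ∀ {Z A B Q} (m : Hom Z A) (f : Hom Z B) (g : Hom A Q) (n : Hom B Q) →
                    IsPushout m f g n → M m → M n
      M-pullback  : ∀ {P A B Z} (p₁ : Hom P A) (p₂ : Hom P B) (f : Hom A Z) (m : Hom B Z) →
                    IsPullback p₁ p₂ f m → M m → M p₁
      pushouts    : ∀ {Z A B} (m : Hom Z A) (f : Hom Z B) → M m →
                    Σ Obj λ Q → Σ (Hom A Q) λ g → Σ (Hom B Q) λ n → IsPushout m f g n
      pullbacks   : ∀ {A B Z} (f : Hom A Z) (m : Hom B Z) → M m →
                    Σ Obj λ P → Σ (Hom P A) λ p₁ → Σ (Hom P B) λ p₂ → IsPullback p₁ p₂ f m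
      van-Kampen  : ∀ {A B C′ D} (m : Hom A B) (f : Hom A C′) (g : Hom B D) (n : Hom C′ D) →
                    M m → IsPushout m f g n → IsMVanKampen m f g n

  IsFinitary : Set
  IsFinitary =
    ∀ (X : Obj) → Σ ℕ λ k → Σ (Fin k → Obj) λ S → Σ ((i : Fin k) → Hom (S i) X) λ s →
      (∀ i → M (s i)) ×
      (∀ {Y} (m : Hom Y X) → M m →
        Σ (Fin k) λ i → Σ (Hom Y (S i)) λ h → IsIso h × (s i ∘ h ≈ m))

  IsMInitial : Obj → Set
  IsMInitial I = ∀ (X : Obj) → Σ (Hom I X) λ i → M i × (∀ (j : Hom I X) → M j → j ≈ i)

  HasMInitial : Set
  HasMInitial = Σ Obj IsMInitial

  HasMEffectiveUnions : Set
  HasMEffectiveUnions =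
    ∀ {A B C′ D E} (m₁ : Hom A B) (m₂ : Hom A C′) (n₁ : Hom B D) (n₂ : Hom C′ D)
      (e₁ : Hom B E) (e₂ : Hom C′ E) →
    M m₁ → M m₂ → M n₁ → M n₂ → M e₁ → M e₂ →
    IsPushout m₁ m₂ n₁ n₂ → IsPullback m₁ m₂ e₁ e₂ →
    ∀ (u : Hom D E) → u ∘ n₁ ≈ e₁ → u ∘ n₂ ≈ e₂ → M u

  HasEpiMFactorization : Set
  HasEpiMFactorization =
    ∀ {A B} (f : Hom A B) →
    Σ Obj λ K → Σ (Hom A K) λ e → Σ (Hom K B) λ m →
      Epi e × M m × (m ∘ e ≈ f) ×
      (∀ {K′} (e′ : Hom A K′) (m′ : Hom K′ B) → Epi e′ → M m′ → m′ ∘ e′ ≈ f →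
        Σ (Hom K K′) λ i → IsIso i × (i ∘ e ≈ e′) × (m′ ∘ i ≈ m))

  IsFPC : ∀ {A B C′ D} (a : Hom A B) (b : Hom B D) (d : Hom A C′) (c : Hom C′ D) → Set
  IsFPC {A} {B} {C′} {D} a b d c =
    IsPullback a d b c ×
    (∀ {X Y} (p : Hom X A) (q : Hom X Y) (r : Hom Y D) →
      IsPullback (a ∘ p) q b r →
      Σ (Hom Y C′) λ s → (c ∘ s ≈ r) × (s ∘ q ≈ d ∘ p) ×
        (∀ (s′ : Hom Y C′) → c ∘ s′ ≈ r → s′ ∘ q ≈ d ∘ p → s′ ≈ s))

  HasFPCsAlongM : Set
  HasFPCsAlongM =
    ∀ {A B D} (a : Hom A B) (b : Hom B D) → M a → M b →
    Σ Obj λ C′ → Σ (Hom A C′) λ d → Σ (Hom C′ D) λ c → IsFPC a b d c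

  MStableUnderFPC : Set
  MStableUnderFPC =
    ∀ {A B C′ D} (a : Hom A B) (b : Hom B D) (d : Hom A C′) (c : Hom C′ D) →
    M a → M b → IsFPC a b d c → M d × M c

-- The restricted powerset functor P^(1,2): a subset {x , y} with 1 ≤ size ≤ 2
-- is represented by the pair (x , y) (x ≡ y gives the singleton), with
-- pairs identified up to swapping (this is exactly equality of the subsets).

UPair : Set → Set
UPair V = V × V

infix 4 _≈ᵤ_
_≈ᵤ_ : ∀ {V : Set} → UPair V → UPair V → Set
(a , b) ≈ᵤ (c , d) = (a ≡ c × b ≡ d) ⊎ (a ≡ d × b ≡ c)

P12 : ∀ {V W : Set} → (V → W) → UPair V → UPair W
P12 f (a , b) = (f a , f b)

≈ᵤ-refl : ∀ {V} {p : UPair V} → p ≈ᵤ p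
≈ᵤ-refl = inj₁ (refl , refl)

≈ᵤ-sym : ∀ {V} {p q : UPair V} → p ≈ᵤ q → q ≈ᵤ p
≈ᵤ-sym {p = _ , _} {q = _ , _} (inj₁ (refl , refl)) = inj₁ (refl , refl)
≈ᵤ-sym {p = _ , _} {q = _ , _} (inj₂ (refl , refl)) = inj₂ (refl , refl)

≈ᵤ-trans : ∀ {V} {p q r : UPair V} → p ≈ᵤ q → q ≈ᵤ r → p ≈ᵤ r
≈ᵤ-trans {p = _ , _} {q = _ , _} {r = _ , _} (inj₁ (refl , refl)) y = y
≈ᵤ-trans {p = _ , _} {q = _ , _} {r = _ , _} (inj₂ (refl , refl)) (inj₁ (refl , refl)) = inj₂ (refl , refl)
≈ᵤ-trans {p = _ , _} {q = _ , _} {r = _ , _} (inj₂ (refl , refl)) (inj₂ (refl , refl)) = inj₁ (refl , refl)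

P12-cong : ∀ {V W} (f : V → W) {p q : UPair V} → p ≈ᵤ q → P12 f p ≈ᵤ P12 f q
P12-cong f {_ , _} {_ , _} (inj₁ (refl , refl)) = inj₁ (refl , refl)
P12-cong f {_ , _} {_ , _} (inj₂ (refl , refl)) = inj₂ (refl , refl)

record Graph : Set where
  field
    nE  : ℕ
    nV  : ℕ
    inc : Fin nE → UPair (Fin nV)
open Graph

record GraphHom (G H : Graph) : Set where
  field
    φE   : Fin (nE G) → Fin (nE H)
    φV   : Fin (nV G) → Fin (nV H)
    comm : ∀ (e : Fin (nE G)) → inc H (φE e) ≈ᵤ P12 φV (inc G e)
open GraphHom

infix 4 _≈ₕ_
_≈ₕ_ : ∀ {G H} → GraphHom G H → GraphHom G H → Set
f ≈ₕ g = (∀ e → φE f e ≡ φE g e) × (∀ v → φV f v ≡ φV g v)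

idₕ : ∀ {G} → GraphHom G G
idₕ = record { φE = λ e → e ; φV = λ v → v ; comm = λ e → ≈ᵤ-refl }

_∘ₕ_ : ∀ {G H K} → GraphHom H K → GraphHom G H → GraphHom G K
_∘ₕ_ {G} {H} {K} g f = record
  { φE   = λ e → φE g (φE f e)
  ; φV   = λ v → φV g (φV f v)
  ; comm = λ e → ≈ᵤ-trans (comm g (φE f e)) (P12-cong (φV g) (comm f e))
  }

uGraph : Category
uGraph = record
  { Obj = Graph
  ; Hom = GraphHom
  ; _≈_ = _≈ₕ_
  ; id  = idₕ
  ; _∘_ = _∘ₕ_
  ; ≈-equiv = record
      { refl  = (λ _ → refl) , (λ _ → refl)
      ; sym   = λ p → (λ e → sym (proj₁ p e)) , (λ v → sym (proj₂ p v))
      ; trans = λ p q → (λ e → trans (proj₁ p e) (proj₁ q e))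
                      , (λ v → trans (proj₂ p v) (proj₂ q v))
      }
  ; ∘-resp-≈ = λ {_} {_} {_} {f} {f′} {g} {g′} p q →
      (λ e → trans (cong (φE f) (proj₁ q e)) (proj₁ p (φE g′ e)))
    , (λ v → trans (cong (φV f) (proj₂ q v)) (proj₂ p (φV g′ v)))
  ; identityˡ = (λ _ → refl) , (λ _ → refl)
  ; identityʳ = (λ _ → refl) , (λ _ → refl)
  ; assoc     = (λ _ → refl) , (λ _ → refl)
  }

Mᵤ : ∀ {G H : Graph} → GraphHom G H → Set
Mᵤ f = Injective _≡_ _≡_ (φE f) × Injective _≡_ _≡_ (φV f)

open Notions uGraph Mᵤ public

-- Limits and colimits along M in uGraph are computed componentwise. A square of graph
-- morphisms is a pullback along M, or a pushout along M, exactly when its edge square and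
-- its vertex square are pullbacks, resp. pushouts, of finite sets: the incidence maps come
-- along for free because an injective vertex map reflects unordered pairs. So M-adhesivity,
-- the van Kampen property and effective unions reduce to elementwise reasoning in Set, where
-- the pushout of an injection m along f is the codomain of f plus the complement of the
-- image of m. The final pullback complement of a followed by b is D without the part of
-- b(B) outside b(a(A)), and it is unique up to isomorphism, so its second leg is always in
-- M. Epimorphisms are the surjective morphisms, so every morphism factors through its
-- image; and an M-subobject is determined by its image, a subset of the finitely many
-- edges and vertices.

module Submission where

open import Defs
open import Data.Nat using (ℕ; zero; suc; _+_; _^_)
open import Data.Fin using (Fin; zero; suc; join; splitAt; finToFun; funToFin)
open import Data.Fin.Properties
  using (suc-injective; any?; _≟_; join-splitAt; splitAt-join; finToFun-funToFin)
open import Data.Product using (Σ; _×_; _,_; proj₁; proj₂)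
open import Data.Sum using (_⊎_; inj₁; inj₂; [_,_]′)
open import Data.Sum.Properties using (inj₁-injective; inj₂-injective)
open import Data.Empty using (⊥-elim)
open import Function using (_∘′_)
open import Function.Definitions using (Injective)
open import Level using (0ℓ)
open import Relation.Nullary using (Dec; yes; no; ¬_; ¬?)
open import Relation.Nullary.Decidable using (_⊎-dec_; _×-dec_)
open import Relation.Unary using (Decidable)
open import Relation.Binary.Bundles using (Setoid)
open import Relation.Binary.Structures using (IsEquivalence)
open import Relation.Binary.PropositionalEquality
import Relation.Binary.Reasoning.Setoid as SetoidReasoning

open Graph
open GraphHom

module CategoryFacts (𝒞 : Category) (M : ∀ {A B} → Category.Hom 𝒞 A B → Set) where
  open Category 𝒞
  private
    module N = Notions 𝒞 M
    module ≈ {A B} = IsEquivalence (≈-equiv {A} {B})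

  ∘-pull : ∀ {A B C D} {f : Hom C D} {g : Hom B C} {h : Hom A B} {k : Hom A C} →
           g ∘ h ≈ k → (f ∘ g) ∘ h ≈ f ∘ k
  ∘-pull gh≈k = ≈.trans assoc (∘-resp-≈ ≈.refl gh≈k)

  pullback-jointly-monic : ∀ {P A B Z} {p₁ : Hom P A} {p₂ : Hom P B} {f : Hom A Z} {g : Hom B Z} →
                           N.IsPullback p₁ p₂ f g → ∀ {X} (u v : Hom X P) →
                           p₁ ∘ u ≈ p₁ ∘ v → p₂ ∘ u ≈ p₂ ∘ v → u ≈ v
  pullback-jointly-monic {p₁ = p₁} {p₂} {f} {g} pb u v p₁u≈p₁v p₂u≈p₂v =
    let (_ , _ , _ , unique) = universal (p₁ ∘ u) (p₂ ∘ u) square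
    in ≈.trans (unique u ≈.refl ≈.refl)
               (≈.sym (unique v (≈.sym p₁u≈p₁v) (≈.sym p₂u≈p₂v)))
    where
      open N.IsPullback pb
      square : f ∘ (p₁ ∘ u) ≈ g ∘ (p₂ ∘ u)
      square = ≈.trans (≈.sym assoc) (≈.trans (∘-resp-≈ commutes ≈.refl) assoc)

  IsPullback-sym : ∀ {P A B Z} {p₁ : Hom P A} {p₂ : Hom P B} {f : Hom A Z} {g : Hom B Z} →
                   N.IsPullback p₁ p₂ f g → N.IsPullback p₂ p₁ g f
  IsPullback-sym pb = record
    { commutes  = ≈.sym commutes
    ; universal = λ h₁ h₂ eq →
        let (u , p₁u , p₂u , unique) = universal h₂ h₁ (≈.sym eq)
        in u , p₂u , p₁u , λ u′ p₂u′ p₁u′ → unique u′ p₁u′ p₂u′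
    }
    where open N.IsPullback pb

  IsPullback-∘-idʳ : ∀ {P A B Z} {p₁ : Hom P A} {p₂ : Hom P B} {f : Hom A Z} {g : Hom B Z} →
                     N.IsPullback p₁ p₂ f g → N.IsPullback (p₁ ∘ id) p₂ f g
  IsPullback-∘-idʳ pb = record
    { commutes  = ≈.trans (∘-resp-≈ ≈.refl identityʳ) commutes
    ; universal = λ h₁ h₂ eq →
        let (u , p₁u , p₂u , unique) = universal h₁ h₂ eq
        in u , ≈.trans (∘-pull identityˡ) p₁u , p₂u
             , λ u′ p₁u′ p₂u′ →
                 unique u′ (≈.trans (≈.sym (∘-pull identityˡ)) p₁u′) p₂u′
    }
    where open N.IsPullback pb

  pushout-endo≈id : ∀ {Z A B Q} {m : Hom Z A} {f : Hom Z B} {g : Hom A Q} {n : Hom B Q} →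
                    N.IsPushout m f g n → (x : Hom Q Q) → x ∘ g ≈ g → x ∘ n ≈ n → x ≈ id
  pushout-endo≈id {g = g} {n = n} po x xg≈g xn≈n =
    let (_ , _ , _ , unique) = universal g n commutes
    in ≈.trans (unique x xg≈g xn≈n) (≈.sym (unique id identityˡ identityˡ))
    where open N.IsPushout po

  pushout-unique : ∀ {Z A B Q₀ Q} {m : Hom Z A} {f : Hom Z B}
                   {g₀ : Hom A Q₀} {n₀ : Hom B Q₀} {g : Hom A Q} {n : Hom B Q} →
                   N.IsPushout m f g₀ n₀ → N.IsPushout m f g n →
                   Σ (Hom Q₀ Q) λ u → Σ (Hom Q Q₀) λ v →
                     (u ∘ v ≈ id) × (v ∘ u ≈ id) × (u ∘ g₀ ≈ g) × (u ∘ n₀ ≈ n)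
  pushout-unique {g₀ = g₀} {n₀} {g} {n} po₀ po =
    let (u , ug₀ , un₀ , _) = N.IsPushout.universal po₀ g n (N.IsPushout.commutes po)
        (v , vg , vn , _)   = N.IsPushout.universal po g₀ n₀ (N.IsPushout.commutes po₀)
    in u , v
     , pushout-endo≈id po (u ∘ v) (≈.trans (∘-pull vg) ug₀) (≈.trans (∘-pull vn) un₀)
     , pushout-endo≈id po₀ (v ∘ u) (≈.trans (∘-pull ug₀) vg) (≈.trans (∘-pull un₀) vn)
     , ug₀ , un₀

  FPC-mediator : ∀ {A B C C₀ D} {a : Hom A B} {b : Hom B D} {d : Hom A C} {c : Hom C D}
                 {d₀ : Hom A C₀} {c₀ : Hom C₀ D} → N.IsFPC a b d c → N.IsPullback a d₀ b c₀ →
                 Σ (Hom C₀ C) λ s → (c ∘ s ≈ c₀) × (s ∘ d₀ ≈ d)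
  FPC-mediator {d₀ = d₀} {c₀} (_ , final) pb₀ =
    let (s , cs≈c₀ , sd₀≈d , _) = final id d₀ c₀ (IsPullback-∘-idʳ pb₀)
    in s , cs≈c₀ , ≈.trans sd₀≈d identityʳ

  FPC-endo≈id : ∀ {A B C D} {a : Hom A B} {b : Hom B D} {d : Hom A C} {c : Hom C D} →
                N.IsFPC a b d c → (x : Hom C C) → c ∘ x ≈ c → x ∘ d ≈ d → x ≈ id
  FPC-endo≈id {d = d} {c} (pb , final) x cx≈c xd≈d =
    let (_ , _ , _ , unique) = final id d c (IsPullback-∘-idʳ pb)
    in ≈.trans (unique x cx≈c (≈.trans xd≈d (≈.sym identityʳ)))
               (≈.sym (unique id identityʳ (≈.trans identityˡ (≈.sym identityʳ))))

  FPC-unique : ∀ {A B C C₀ D} {a : Hom A B} {b : Hom B D} {d : Hom A C} {c : Hom C D}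
               {d₀ : Hom A C₀} {c₀ : Hom C₀ D} → N.IsFPC a b d c → N.IsFPC a b d₀ c₀ →
               Σ (Hom C C₀) λ s → N.IsIso s × (c₀ ∘ s ≈ c)
  FPC-unique fpc fpc₀ =
    let (s , c₀s≈c , sd≈d₀) = FPC-mediator fpc₀ (proj₁ fpc)
        (t , ct≈c₀ , td₀≈d) = FPC-mediator fpc (proj₁ fpc₀)
    in s
     , ( t
       , FPC-endo≈id fpc (t ∘ s) (∘-pullˡ ct≈c₀ c₀s≈c) (≈.trans (∘-pull sd≈d₀) td₀≈d)
       , FPC-endo≈id fpc₀ (s ∘ t) (∘-pullˡ c₀s≈c ct≈c₀) (≈.trans (∘-pull td₀≈d) sd≈d₀))
     , c₀s≈c
    where
      ∘-pullˡ : ∀ {W X Y Z} {f : Hom Y Z} {g : Hom X Y} {h : Hom W X} {k : Hom X Z} {l : Hom W Z} →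
                f ∘ g ≈ k → k ∘ h ≈ l → f ∘ (g ∘ h) ≈ l
      ∘-pullˡ fg≈k kh≈l = ≈.trans (≈.sym assoc) (≈.trans (∘-resp-≈ fg≈k ≈.refl) kh≈l)

open CategoryFacts uGraph Mᵤ

Inj : ∀ {A B : Set} → (A → B) → Set
Inj = Injective _≡_ _≡_

fiber : ∀ {A B : Set} → (A → B) → B → Set
fiber {A} f y = Σ A λ x → f x ≡ y

Both : ∀ {V : Set} → (V → Set) → UPair V → Set
Both P (a , b) = P a × P b

≈ᵤ-setoid : Set → Setoid 0ℓ 0ℓ
≈ᵤ-setoid V = record
  { Carrier = UPair V ; _≈_ = _≈ᵤ_
  ; isEquivalence = record { refl = ≈ᵤ-refl ; sym = ≈ᵤ-sym ; trans = ≈ᵤ-trans } }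

≡⇒≈ᵤ : ∀ {V} {p q : UPair V} → p ≡ q → p ≈ᵤ q
≡⇒≈ᵤ refl = ≈ᵤ-refl

P12-≗ : ∀ {V W} {f g : V → W} → f ≗ g → ∀ p → P12 f p ≡ P12 g p
P12-≗ f≗g (a , b) = cong₂ _,_ (f≗g a) (f≗g b)

P12-reflects : ∀ {V W} {f : V → W} → Inj f → ∀ {p q} → P12 f p ≈ᵤ P12 f q → p ≈ᵤ q
P12-reflects f-inj (inj₁ (x , y)) = inj₁ (f-inj x , f-inj y)
P12-reflects f-inj (inj₂ (x , y)) = inj₂ (f-inj x , f-inj y)

Both-≈ᵤ-P12 : ∀ {V W} {f : V → W} {P : W → Set} → (∀ v → P (f v)) →
              ∀ {p q} → p ≈ᵤ P12 f q → Both P p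
Both-≈ᵤ-P12 Pf (inj₁ (refl , refl)) = Pf _ , Pf _
Both-≈ᵤ-P12 Pf (inj₂ (refl , refl)) = Pf _ , Pf _

endpoints-fiber : ∀ {V W} {f : V → W} {p q} → p ≈ᵤ P12 f q → Both (fiber f) p
endpoints-fiber {f = f} = Both-≈ᵤ-P12 {P = fiber f} (λ v → v , refl)

P12-align : ∀ {V W Z : Set} (f : V → Z) (g : W → Z) p q → P12 f p ≈ᵤ P12 g q →
            Σ (UPair W) λ q′ → q ≈ᵤ q′ ×
              f (proj₁ p) ≡ g (proj₁ q′) × f (proj₂ p) ≡ g (proj₂ q′)
P12-align f g p (c , d) (inj₁ (x , y)) = (c , d) , ≈ᵤ-refl , x , y
P12-align f g p (c , d) (inj₂ (x , y)) = (d , c) , inj₂ (refl , refl) , x , y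

module _ {P W : Graph} (q : GraphHom P W) (qⱽ-injective : Inj (φV q)) where

  -- An injective vertex map reflects incidence, so edge and vertex maps lifting h along q
  -- automatically form a morphism.
  lift : ∀ {X} (h : GraphHom X W) (uᴱ : Fin (nE X) → Fin (nE P)) (uⱽ : Fin (nV X) → Fin (nV P)) →
         φE q ∘′ uᴱ ≗ φE h → φV q ∘′ uⱽ ≗ φV h → GraphHom X P
  lift {X} h uᴱ uⱽ quᴱ≗h quⱽ≗h = record
    { φE = uᴱ ; φV = uⱽ ; comm = λ e → P12-reflects qⱽ-injective (image-comm e) }
    where
      open SetoidReasoning (≈ᵤ-setoid (Fin (nV W)))
      image-comm : ∀ e → P12 (φV q) (inc P (uᴱ e)) ≈ᵤ P12 (φV q) (P12 uⱽ (inc X e))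
      image-comm e = begin
        P12 (φV q) (inc P (uᴱ e))     ≈⟨ comm q (uᴱ e) ⟨
        inc W (φE q (uᴱ e))           ≡⟨ cong (inc W) (quᴱ≗h e) ⟩
        inc W (φE h e)                ≈⟨ comm h e ⟩
        P12 (φV h) (inc X e)          ≡⟨ P12-≗ quⱽ≗h (inc X e) ⟨
        P12 (φV q) (P12 uⱽ (inc X e)) ∎

  factor-through : ∀ {X} (h : GraphHom X W) →
                   (∀ e → fiber (φE q) (φE h e)) → (∀ v → fiber (φV q) (φV h v)) →
                   Σ (GraphHom X P) λ s → q ∘ₕ s ≈ₕ h
  factor-through h liftᴱ liftⱽ =
    lift h (λ e → proj₁ (liftᴱ e)) (λ v → proj₁ (liftⱽ v))
           (λ e → proj₂ (liftᴱ e)) (λ v → proj₂ (liftⱽ v))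
    , (λ e → proj₂ (liftᴱ e)) , (λ v → proj₂ (liftⱽ v))

Surjective : ∀ {G H} → GraphHom G H → Set
Surjective h = (∀ e → fiber (φE h) e) × (∀ v → fiber (φV h) v)

bijective⇒iso : ∀ {G H} (h : GraphHom G H) → Mᵤ h → Surjective h → IsIso h
bijective⇒iso h (hᴱ-injective , hⱽ-injective) (surjᴱ , surjⱽ)
  with factor-through h hⱽ-injective idₕ surjᴱ surjⱽ
... | k , hk≈id = k , ((λ e → hᴱ-injective (proj₁ hk≈id (φE h e)))
                      , (λ v → hⱽ-injective (proj₂ hk≈id (φV h v))))
                    , hk≈id

iso⇒injective : ∀ {G H} (h : GraphHom G H) → IsIso h → Mᵤ h
iso⇒injective h (k , (khᴱ , khⱽ) , _) =
    (λ {x} {y} hx≡hy → trans (sym (khᴱ x)) (trans (cong (φE k) hx≡hy) (khᴱ y)))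
  , (λ {x} {y} hx≡hy → trans (sym (khⱽ x)) (trans (cong (φV k) hx≡hy) (khⱽ y)))

Mᵤ-mono : ∀ {G H} (m : GraphHom G H) → Mᵤ m → Mono m
Mᵤ-mono _ (mᴱ-injective , mⱽ-injective) _ _ (mgᴱ≗mhᴱ , mgⱽ≗mhⱽ) =
  (λ e → mᴱ-injective (mgᴱ≗mhᴱ e)) , (λ v → mⱽ-injective (mgⱽ≗mhⱽ v))

Mᵤ-resp-≈ : ∀ {G H} (f g : GraphHom G H) → f ≈ₕ g → Mᵤ f → Mᵤ g
Mᵤ-resp-≈ _ _ (fᴱ≗gᴱ , fⱽ≗gⱽ) (fᴱ-injective , fⱽ-injective) =
    (λ {x} {y} gx≡gy → fᴱ-injective (trans (fᴱ≗gᴱ x) (trans gx≡gy (sym (fᴱ≗gᴱ y)))))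
  , (λ {x} {y} gx≡gy → fⱽ-injective (trans (fⱽ≗gⱽ x) (trans gx≡gy (sym (fⱽ≗gⱽ y)))))

M-cancelʳ : ∀ {G H K} (g : GraphHom H K) (h : GraphHom G H) (k : GraphHom G K) →
            g ∘ₕ h ≈ₕ k → Mᵤ k → Mᵤ h
M-cancelʳ g h k (ghᴱ≗k , ghⱽ≗k) (kᴱ-injective , kⱽ-injective) =
    (λ {x} {y} hx≡hy →
       kᴱ-injective (trans (sym (ghᴱ≗k x)) (trans (cong (φE g) hx≡hy) (ghᴱ≗k y))))
  , (λ {x} {y} hx≡hy →
       kⱽ-injective (trans (sym (ghⱽ≗k x)) (trans (cong (φV g) hx≡hy) (ghⱽ≗k y))))

factor-surjective : ∀ {G H K} (g : GraphHom H K) (h : GraphHom G H) (k : GraphHom G K) →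
                    g ∘ₕ h ≈ₕ k → Mᵤ g →
                    (∀ x → fiber (φE k) (φE g x)) → (∀ v → fiber (φV k) (φV g v)) → Surjective h
factor-surjective g h k (ghᴱ≗k , ghⱽ≗k) (gᴱ-injective , gⱽ-injective) kᴱ-covers kⱽ-covers =
    (λ x → let (y , ky≡gx) = kᴱ-covers x in y , gᴱ-injective (trans (ghᴱ≗k y) ky≡gx))
  , (λ v → let (y , ky≡gv) = kⱽ-covers v in y , gⱽ-injective (trans (ghⱽ≗k y) ky≡gv))

Surjective-cancelʳ : ∀ {G H K} (g : GraphHom H K) (h : GraphHom G H) (k : GraphHom G K) →
                     g ∘ₕ h ≈ₕ k → Surjective k → Surjective g
Surjective-cancelʳ g h k (ghᴱ≗k , ghⱽ≗k) (kᴱ-surjective , kⱽ-surjective) =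
    (λ x → let (y , ky≡x) = kᴱ-surjective x in φE h y , trans (ghᴱ≗k y) ky≡x)
  , (λ v → let (y , ky≡v) = kⱽ-surjective v in φV h y , trans (ghⱽ≗k y) ky≡v)

record Enumeration {n : ℕ} (P : Fin n → Set) : Set where
  field
    size            : ℕ
    embed           : Fin size → Fin n
    embed-injective : Inj embed
    embed-∈         : ∀ i → P (embed i)
    embed-covers    : ∀ x → P x → fiber embed x

enumerate : ∀ {n} {P : Fin n → Set} → Decidable P → Enumeration P
enumerate {zero} _ = record
  { size = 0 ; embed = λ () ; embed-injective = λ {} ; embed-∈ = λ () ; embed-covers = λ () }
enumerate {suc n} {P} P? with enumerate {P = λ x → P (suc x)} (λ x → P? (suc x)) | P? zero
... | E | yes P0 = record
  { size = suc size ; embed = embed′ ; embed-injective = injective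
  ; embed-∈ = ∈ ; embed-covers = covers }
  where
    open Enumeration E
    embed′ : Fin (suc size) → Fin (suc n)
    embed′ zero    = zero
    embed′ (suc i) = suc (embed i)
    injective : Inj embed′
    injective {zero}  {zero}  _ = refl
    injective {suc i} {suc j} e = cong suc (embed-injective (suc-injective e))
    ∈ : ∀ i → P (embed′ i)
    ∈ zero    = P0
    ∈ (suc i) = embed-∈ i
    covers : ∀ x → P x → fiber embed′ x
    covers zero    _  = zero , refl
    covers (suc x) Px with embed-covers x Px
    ... | i , refl = suc i , refl
... | E | no ¬P0 = record
  { size = size ; embed = suc ∘′ embed ; embed-injective = embed-injective ∘′ suc-injective
  ; embed-∈ = embed-∈ ; embed-covers = covers }
  where
    open Enumeration E
    covers : ∀ x → P x → fiber (suc ∘′ embed) x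
    covers zero    P0 = ⊥-elim (¬P0 P0)
    covers (suc x) Px with embed-covers x Px
    ... | i , refl = i , refl

record Subgraph (X : Graph) (PE : Fin (nE X) → Set) (PV : Fin (nV X) → Set) : Set where
  field
    graph         : Graph
    ι             : GraphHom graph X
    ι-M           : Mᵤ ι
    edge-∈        : ∀ e → PE (φE ι e)
    vertex-∈      : ∀ v → PV (φV ι v)
    edge-covers   : ∀ x → PE x → fiber (φE ι) x
    vertex-covers : ∀ x → PV x → fiber (φV ι) x

  factor-through-ι : ∀ {Y} (h : GraphHom Y X) → (∀ e → PE (φE h e)) → (∀ v → PV (φV h v)) →
                     Σ (GraphHom Y graph) λ s → ι ∘ₕ s ≈ₕ h
  factor-through-ι h hᴱ-∈ hⱽ-∈ =
    factor-through ι (proj₂ ι-M) h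
      (λ e → edge-covers _ (hᴱ-∈ e)) (λ v → vertex-covers _ (hⱽ-∈ v))

subgraph : (X : Graph) {PE : Fin (nE X) → Set} {PV : Fin (nV X) → Set} → Decidable PE → Decidable PV →
           (∀ e → PE e → Both PV (inc X e)) → Subgraph X PE PV
subgraph X {PE} {PV} PE? PV? PE⇒PV = record
  { graph = S ; ι = ι ; ι-M = embed-injective Eᴱ , embed-injective Eⱽ
  ; edge-∈ = embed-∈ Eᴱ ; vertex-∈ = embed-∈ Eⱽ
  ; edge-covers = embed-covers Eᴱ ; vertex-covers = embed-covers Eⱽ }
  where
    open Enumeration
    Eᴱ = enumerate PE?
    Eⱽ = enumerate PV?
    restrict : ∀ {x} → PV x → Fin (size Eⱽ)
    restrict Px = proj₁ (embed-covers Eⱽ _ Px)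
    restrict-embed : ∀ {x} (Px : PV x) → embed Eⱽ (restrict Px) ≡ x
    restrict-embed Px = proj₂ (embed-covers Eⱽ _ Px)
    S : Graph
    S = record { nE = size Eᴱ ; nV = size Eⱽ
               ; inc = λ j → let (P₁ , P₂) = PE⇒PV (embed Eᴱ j) (embed-∈ Eᴱ j)
                             in restrict P₁ , restrict P₂ }
    ι : GraphHom S X
    ι = record { φE = embed Eᴱ ; φV = embed Eⱽ
               ; comm = λ _ → inj₁ (sym (restrict-embed _) , sym (restrict-embed _)) }

-- Pullbacks

record IsSetPullback {P A B Z : Set} (p₁ : P → A) (p₂ : P → B) (f : A → Z) (g : B → Z) : Set where
  field
    commute           : ∀ x → f (p₁ x) ≡ g (p₂ x)
    jointly-injective : ∀ {x y} → p₁ x ≡ p₁ y → p₂ x ≡ p₂ y → x ≡ y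
    complete          : ∀ a b → f a ≡ g b → Σ P λ x → p₁ x ≡ a × p₂ x ≡ b

  p₁-injective : Inj g → Inj p₁
  p₁-injective g-injective {x} {y} p₁x≡p₁y = jointly-injective p₁x≡p₁y
    (g-injective (trans (sym (commute x)) (trans (cong f p₁x≡p₁y) (commute y))))

IsSetPullback-sym : ∀ {P A B Z : Set} {p₁ : P → A} {p₂ : P → B} {f : A → Z} {g : B → Z} →
                    IsSetPullback p₁ p₂ f g → IsSetPullback p₂ p₁ g f
IsSetPullback-sym pb = record
  { commute           = λ x → sym (commute x)
  ; jointly-injective = λ p₂≡ p₁≡ → jointly-injective p₁≡ p₂≡
  ; complete          = λ b a e → let (x , p₁x , p₂x) = complete a b (sym e) in x , p₂x , p₁x
  }
  where open IsSetPullback pb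

-- Morphisms out of point and edge probe single vertices and edges.
point : Graph
point = record { nE = 0 ; nV = 1 ; inc = λ () }

point-at : ∀ (G : Graph) → Fin (nV G) → GraphHom point G
point-at G v = record { φE = λ () ; φV = λ _ → v ; comm = λ () }

edge : Graph
edge = record { nE = 1 ; nV = 2 ; inc = λ _ → zero , suc zero }

edge-at : ∀ (G : Graph) (e : Fin (nE G)) (x y : Fin (nV G)) → inc G e ≈ᵤ (x , y) → GraphHom edge G
edge-at G e x y e≈xy = record { φE = λ _ → e ; φV = endpoint ; comm = λ _ → e≈xy }
  where
    endpoint : Fin 2 → Fin (nV G)
    endpoint zero    = x
    endpoint (suc _) = y

module PullbackComponents {P A B Z} {p₁ : GraphHom P A} {p₂ : GraphHom P B}
                          {f : GraphHom A Z} {g : GraphHom B Z} (pb : IsPullback p₁ p₂ f g) where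
  open IsPullback pb

  vertex-pullback : IsSetPullback (φV p₁) (φV p₂) (φV f) (φV g)
  vertex-pullback = record
    { commute           = proj₂ commutes
    ; jointly-injective = λ {x} {y} p₁≡ p₂≡ →
        proj₂ (pullback-jointly-monic pb (point-at P x) (point-at P y)
                 ((λ ()) , λ _ → p₁≡) ((λ ()) , λ _ → p₂≡)) zero
    ; complete          = λ a b e →
        let (u , p₁u , p₂u , _) = universal (point-at A a) (point-at B b) ((λ ()) , λ _ → e)
        in φV u zero , proj₂ p₁u zero , proj₂ p₂u zero
    }

  edge-pullback : Inj (φV g) → IsSetPullback (φE p₁) (φE p₂) (φE f) (φE g)
  edge-pullback gⱽ-injective = record
    { commute = proj₁ commutes ; jointly-injective = jointly-injective ; complete = complete }
    where
      open SetoidReasoning (≈ᵤ-setoid (Fin (nV Z)))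
      p₁ⱽ-injective : Inj (φV p₁)
      p₁ⱽ-injective = IsSetPullback.p₁-injective vertex-pullback gⱽ-injective

      jointly-injective : ∀ {x y} → φE p₁ x ≡ φE p₁ y → φE p₂ x ≡ φE p₂ y → x ≡ y
      jointly-injective {x} {y} p₁≡ p₂≡ =
        proj₁ (pullback-jointly-monic pb at-x at-y
                 ((λ _ → p₁≡) , λ { zero → refl ; (suc zero) → refl })
                 ((λ _ → p₂≡) , λ { zero → refl ; (suc zero) → refl })) zero
        where
          y≈x : inc P y ≈ᵤ inc P x
          y≈x = P12-reflects p₁ⱽ-injective
                  (≈ᵤ-trans (≈ᵤ-sym (comm p₁ y))
                  (≈ᵤ-trans (≡⇒≈ᵤ (cong (inc A) (sym p₁≡))) (comm p₁ x)))
          at-x = edge-at P x (proj₁ (inc P x)) (proj₂ (inc P x)) ≈ᵤ-refl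
          at-y = edge-at P y (proj₁ (inc P x)) (proj₂ (inc P x)) y≈x

      complete : ∀ a b → φE f a ≡ φE g b → Σ (Fin (nE P)) λ x → φE p₁ x ≡ a × φE p₂ x ≡ b
      complete a b fa≡gb with P12-align (φV f) (φV g) (inc A a) (inc B b) images
        where
          images : P12 (φV f) (inc A a) ≈ᵤ P12 (φV g) (inc B b)
          images = begin
            P12 (φV f) (inc A a) ≈⟨ comm f a ⟨
            inc Z (φE f a)       ≡⟨ cong (inc Z) fa≡gb ⟩
            inc Z (φE g b)       ≈⟨ comm g b ⟩
            P12 (φV g) (inc B b) ∎
      ... | (b₁ , b₂) , b≈b₁b₂ , fa₁≡gb₁ , fa₂≡gb₂ =
        let (u , p₁u , p₂u , _) =
              universal (edge-at A a _ _ ≈ᵤ-refl) (edge-at B b b₁ b₂ b≈b₁b₂)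
                        ((λ _ → fa≡gb) , λ { zero → fa₁≡gb₁ ; (suc zero) → fa₂≡gb₂ })
        in φE u zero , proj₁ p₁u zero , proj₁ p₂u zero

-- P12 does not preserve pullbacks; a vertex-injective leg makes the mediating maps respect
-- incidence.
set-pullbacks⇒pullback : ∀ {P A B Z} {p₁ : GraphHom P A} {p₂ : GraphHom P B}
                         {f : GraphHom A Z} {g : GraphHom B Z} →
                         IsSetPullback (φE p₁) (φE p₂) (φE f) (φE g) →
                         IsSetPullback (φV p₁) (φV p₂) (φV f) (φV g) →
                         Inj (φV p₁) ⊎ Inj (φV p₂) → IsPullback p₁ p₂ f g
set-pullbacks⇒pullback {P} {A} {B} {p₁ = p₁} {p₂} {f} {g} pbᴱ pbⱽ some-leg-injective = record
  { commutes = IsSetPullback.commute pbᴱ , IsSetPullback.commute pbⱽ ; universal = universal }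
  where
    universal : ∀ {X} (h₁ : GraphHom X A) (h₂ : GraphHom X B) → f ∘ₕ h₁ ≈ₕ g ∘ₕ h₂ →
                Σ (GraphHom X P) λ u → (p₁ ∘ₕ u ≈ₕ h₁) × (p₂ ∘ₕ u ≈ₕ h₂) ×
                  (∀ u′ → p₁ ∘ₕ u′ ≈ₕ h₁ → p₂ ∘ₕ u′ ≈ₕ h₂ → u′ ≈ₕ u)
    universal {X} h₁ h₂ (squareᴱ , squareⱽ) =
      u , (p₁uᴱ , p₁uⱽ) , (p₂uᴱ , p₂uⱽ) , unique
      where
        uᴱ = λ e → IsSetPullback.complete pbᴱ (φE h₁ e) (φE h₂ e) (squareᴱ e)
        uⱽ = λ v → IsSetPullback.complete pbⱽ (φV h₁ v) (φV h₂ v) (squareⱽ v)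
        p₁uᴱ = λ e → proj₁ (proj₂ (uᴱ e))
        p₂uᴱ = λ e → proj₂ (proj₂ (uᴱ e))
        p₁uⱽ = λ v → proj₁ (proj₂ (uⱽ v))
        p₂uⱽ = λ v → proj₂ (proj₂ (uⱽ v))
        lifted : Inj (φV p₁) ⊎ Inj (φV p₂) →
                 ∀ e → inc P (proj₁ (uᴱ e)) ≈ᵤ P12 (λ v → proj₁ (uⱽ v)) (inc X e)
        lifted (inj₁ p₁ⱽ-injective) = comm (lift p₁ p₁ⱽ-injective h₁ _ _ p₁uᴱ p₁uⱽ)
        lifted (inj₂ p₂ⱽ-injective) = comm (lift p₂ p₂ⱽ-injective h₂ _ _ p₂uᴱ p₂uⱽ)
        u : GraphHom X P
        u = record { φE = λ e → proj₁ (uᴱ e) ; φV = λ v → proj₁ (uⱽ v)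
                   ; comm = lifted some-leg-injective }
        unique : ∀ u′ → p₁ ∘ₕ u′ ≈ₕ h₁ → p₂ ∘ₕ u′ ≈ₕ h₂ → u′ ≈ₕ u
        unique u′ (p₁u′ᴱ , p₁u′ⱽ) (p₂u′ᴱ , p₂u′ⱽ) =
            (λ e → IsSetPullback.jointly-injective pbᴱ (trans (p₁u′ᴱ e) (sym (p₁uᴱ e)))
                                                       (trans (p₂u′ᴱ e) (sym (p₂uᴱ e))))
          , (λ v → IsSetPullback.jointly-injective pbⱽ (trans (p₁u′ⱽ v) (sym (p₁uⱽ v)))
                                                       (trans (p₂u′ⱽ v) (sym (p₂uⱽ v))))

restriction-pullback : ∀ {S A B Z : Set} {ι : S → A} {p₂ : S → B} {f : A → Z} {g : B → Z} →
                       Inj ι → Inj g → (∀ s → g (p₂ s) ≡ f (ι s)) →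
                       (∀ a → fiber g (f a) → fiber ι a) → IsSetPullback ι p₂ f g
restriction-pullback {f = f} ι-injective g-injective square covers = record
  { commute           = λ s → sym (square s)
  ; jointly-injective = λ ι≡ _ → ι-injective ι≡
  ; complete          = λ a b fa≡gb →
      let (s , ιs≡a) = covers a (b , sym fa≡gb)
      in s , ιs≡a , g-injective (trans (square s) (trans (cong f ιs≡a) fa≡gb))
  }

module CanonicalPullback {A B Z : Graph} (f : GraphHom A Z) (g : GraphHom B Z) (gM : Mᵤ g) where
  private
    closed : ∀ e → fiber (φE g) (φE f e) → Both (λ v → fiber (φV g) (φV f v)) (inc A e)
    closed e (b , gb≡fe) = endpoints-fiber
      (≈ᵤ-trans (≈ᵤ-sym (comm f e))
                (≈ᵤ-trans (≡⇒≈ᵤ (cong (inc Z) (sym gb≡fe))) (comm g b)))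

  open Subgraph (subgraph A (λ e → any? (λ b → φE g b ≟ φE f e))
                            (λ v → any? (λ b → φV g b ≟ φV f v)) closed) public

  p₂ : GraphHom graph B
  p₂ = lift g (proj₂ gM) (f ∘ₕ ι)
            (λ j → proj₁ (edge-∈ j)) (λ j → proj₁ (vertex-∈ j))
            (λ j → proj₂ (edge-∈ j)) (λ j → proj₂ (vertex-∈ j))

  pullback : IsPullback ι p₂ f g
  pullback = set-pullbacks⇒pullback
    (restriction-pullback (proj₁ ι-M) (proj₁ gM) (λ j → proj₂ (edge-∈ j)) edge-covers)
    (restriction-pullback (proj₂ ι-M) (proj₂ gM) (λ j → proj₂ (vertex-∈ j)) vertex-covers)
    (inj₁ (proj₂ ι-M))

-- Pushouts along M

-- The elementwise shape of a pushout square in Set along an injection m.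
record IsSetPushout {Z A B Q : Set} (m : Z → A) (f : Z → B) (g : A → Q) (n : B → Q) : Set where
  field
    commute            : ∀ z → g (m z) ≡ n (f z)
    jointly-surjective : ∀ q → fiber g q ⊎ fiber n q
    n-injective        : Inj n
    glued              : ∀ a b → g a ≡ n b → Σ Z λ z → m z ≡ a × f z ≡ b
    g-injective-off-m  : ∀ {a a′} → g a ≡ g a′ → a ≡ a′ ⊎ fiber m a

  module Copair {X : Set} (h₁ : A → X) (h₂ : B → X) (square : ∀ z → h₁ (m z) ≡ h₂ (f z)) where

    respects-glue : ∀ a b → g a ≡ n b → h₁ a ≡ h₂ b
    respects-glue a b ga≡nb with glued a b ga≡nb
    ... | z , refl , refl = square z

    h₁-respects-g : ∀ {a a′} → g a ≡ g a′ → h₁ a ≡ h₁ a′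
    h₁-respects-g {a} {a′} ga≡ga′ with g-injective-off-m ga≡ga′
    ... | inj₁ refl     = refl
    ... | inj₂ (z , refl) =
      trans (square z) (sym (respects-glue a′ (f z) (trans (sym ga≡ga′) (commute z))))

    copair : Q → X
    copair q with jointly-surjective q
    ... | inj₁ (a , _) = h₁ a
    ... | inj₂ (b , _) = h₂ b

    copair-≡ : ∀ q x → (∀ a → g a ≡ q → h₁ a ≡ x) → (∀ b → n b ≡ q → h₂ b ≡ x) →
               copair q ≡ x
    copair-≡ q x via-g via-n with jointly-surjective q
    ... | inj₁ (a , ga≡q) = via-g a ga≡q
    ... | inj₂ (b , nb≡q) = via-n b nb≡q

    copair-g : ∀ a → copair (g a) ≡ h₁ a
    copair-g a = copair-≡ (g a) (h₁ a)
      (λ a′ ga′≡ga → h₁-respects-g ga′≡ga)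
      (λ b nb≡ga → sym (respects-glue a b (sym nb≡ga)))

    copair-n : ∀ b → copair (n b) ≡ h₂ b
    copair-n b = copair-≡ (n b) (h₂ b)
      (λ a ga≡nb → respects-glue a b ga≡nb)
      (λ b′ nb′≡nb → cong h₂ (n-injective nb′≡nb))

    copair-unique : ∀ (u : Q → X) → (∀ a → u (g a) ≡ h₁ a) → (∀ b → u (n b) ≡ h₂ b) →
                    ∀ q → u q ≡ copair q
    copair-unique u ug nb q = sym (copair-≡ q (u q)
      (λ a ga≡q → trans (sym (ug a)) (cong u ga≡q))
      (λ b nb≡q → trans (sym (nb b)) (cong u nb≡q)))

IsSetPushout-transport : ∀ {Z A B Q₀ Q : Set} {m : Z → A} {f : Z → B}
                         {g₀ : A → Q₀} {n₀ : B → Q₀} {g : A → Q} {n : B → Q} →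
                         IsSetPushout m f g₀ n₀ → (u : Q₀ → Q) (v : Q → Q₀) →
                         (∀ q → u (v q) ≡ q) → (∀ q → v (u q) ≡ q) →
                         (∀ a → u (g₀ a) ≡ g a) → (∀ b → u (n₀ b) ≡ n b) →
                         IsSetPushout m f g n
IsSetPushout-transport {m = m} {f} {g = g} {n} po u v uv≗id vu≗id ug₀≗g un₀≗n = record
  { commute            = λ z → trans (sym (ug₀≗g (m z))) (trans (cong u (commute z)) (un₀≗n (f z)))
  ; jointly-surjective = surjective
  ; n-injective        = λ {b} {b′} nb≡nb′ →
      n-injective (u-reflects (trans (un₀≗n b) (trans nb≡nb′ (sym (un₀≗n b′)))))
  ; glued              = λ a b ga≡nb →
      glued a b (u-reflects (trans (ug₀≗g a) (trans ga≡nb (sym (un₀≗n b)))))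
  ; g-injective-off-m  = λ {a} {a′} ga≡ga′ →
      g-injective-off-m (u-reflects (trans (ug₀≗g a) (trans ga≡ga′ (sym (ug₀≗g a′)))))
  }
  where
    open IsSetPushout po
    u-reflects : ∀ {x y} → u x ≡ u y → x ≡ y
    u-reflects {x} {y} ux≡uy = trans (sym (vu≗id x)) (trans (cong v ux≡uy) (vu≗id y))
    surjective : ∀ q → fiber g q ⊎ fiber n q
    surjective q with jointly-surjective (v q)
    ... | inj₁ (a , g₀a≡vq) =
      inj₁ (a , trans (sym (ug₀≗g a)) (trans (cong u g₀a≡vq) (uv≗id q)))
    ... | inj₂ (b , n₀b≡vq) =
      inj₂ (b , trans (sym (un₀≗n b)) (trans (cong u n₀b≡vq) (uv≗id q)))

set-pushouts⇒pushout : ∀ {Z A B Q} {m : GraphHom Z A} {f : GraphHom Z B}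
                       {g : GraphHom A Q} {n : GraphHom B Q} →
                       IsSetPushout (φE m) (φE f) (φE g) (φE n) →
                       IsSetPushout (φV m) (φV f) (φV g) (φV n) → IsPushout m f g n
set-pushouts⇒pushout {A = A} {B} {Q} {m} {f} {g} {n} poᴱ poⱽ = record
  { commutes = IsSetPushout.commute poᴱ , IsSetPushout.commute poⱽ ; universal = universal }
  where
    universal : ∀ {X} (h₁ : GraphHom A X) (h₂ : GraphHom B X) → h₁ ∘ₕ m ≈ₕ h₂ ∘ₕ f →
                Σ (GraphHom Q X) λ u → (u ∘ₕ g ≈ₕ h₁) × (u ∘ₕ n ≈ₕ h₂) ×
                  (∀ u′ → u′ ∘ₕ g ≈ₕ h₁ → u′ ∘ₕ n ≈ₕ h₂ → u′ ≈ₕ u)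
    universal {X} h₁ h₂ (squareᴱ , squareⱽ) =
      u , (Uᴱ.copair-g , Uⱽ.copair-g) , (Uᴱ.copair-n , Uⱽ.copair-n)
        , λ u′ (u′gᴱ , u′gⱽ) (u′nᴱ , u′nⱽ) →
            Uᴱ.copair-unique (φE u′) u′gᴱ u′nᴱ , Uⱽ.copair-unique (φV u′) u′gⱽ u′nⱽ
      where
        module Uᴱ = IsSetPushout.Copair poᴱ (φE h₁) (φE h₂) squareᴱ
        module Uⱽ = IsSetPushout.Copair poⱽ (φV h₁) (φV h₂) squareⱽ
        open SetoidReasoning (≈ᵤ-setoid (Fin (nV X)))

        comm-along : ∀ {Y} (k : GraphHom Y Q) (h : GraphHom Y X) →
                     (∀ y → Uᴱ.copair (φE k y) ≡ φE h y) →
                     (∀ v → Uⱽ.copair (φV k v) ≡ φV h v) →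
                     ∀ y → inc X (Uᴱ.copair (φE k y)) ≈ᵤ P12 Uⱽ.copair (inc Q (φE k y))
        comm-along {Y} k h ukᴱ≗h ukⱽ≗h y = begin
          inc X (Uᴱ.copair (φE k y))          ≡⟨ cong (inc X) (ukᴱ≗h y) ⟩
          inc X (φE h y)                      ≈⟨ comm h y ⟩
          P12 (φV h) (inc Y y)                ≡⟨ P12-≗ ukⱽ≗h (inc Y y) ⟨
          P12 Uⱽ.copair (P12 (φV k) (inc Y y)) ≈⟨ P12-cong Uⱽ.copair (comm k y) ⟨
          P12 Uⱽ.copair (inc Q (φE k y))      ∎

        Commutes-at : Fin (nE Q) → Set
        Commutes-at q = inc X (Uᴱ.copair q) ≈ᵤ P12 Uⱽ.copair (inc Q q)

        u-comm : ∀ q → Commutes-at q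
        u-comm q = covered (IsSetPushout.jointly-surjective poᴱ q)
          where
            covered : fiber (φE g) q ⊎ fiber (φE n) q → Commutes-at q
            covered (inj₁ (a , ga≡q)) =
              subst Commutes-at ga≡q (comm-along g h₁ Uᴱ.copair-g Uⱽ.copair-g a)
            covered (inj₂ (b , nb≡q)) =
              subst Commutes-at nb≡q (comm-along n h₂ Uᴱ.copair-n Uⱽ.copair-n b)

        u : GraphHom Q X
        u = record { φE = Uᴱ.copair ; φV = Uⱽ.copair ; comm = u-comm }

-- The pushout of the injection m along f is B ⊎ Fin r, where rest : Fin r → Fin a
-- enumerates the complement of the image of m.
module ComplementPushout {z a : ℕ} {B : Set} (m : Fin z → Fin a) (m-injective : Inj m) (f : Fin z → B)
  where
  private
    m? : ∀ x → Dec (fiber m x)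
    m? x = any? (λ w → m w ≟ x)

  open Enumeration (enumerate (λ x → ¬? (m? x))) public
    renaming (size to r; embed to rest; embed-injective to rest-injective)

  g : Fin a → B ⊎ Fin r
  g x with m? x
  ... | yes (w , _) = inj₁ (f w)
  ... | no x∉m      = inj₂ (proj₁ (embed-covers x x∉m))

  image-or-rest : ∀ x → fiber m x ⊎ fiber rest x
  image-or-rest x with m? x
  ... | yes x∈m = inj₁ x∈m
  ... | no x∉m  = inj₂ (embed-covers x x∉m)

  g-m : ∀ w → g (m w) ≡ inj₁ (f w)
  g-m w with m? (m w)
  ... | yes (w′ , mw′≡mw) = cong (inj₁ ∘′ f) (m-injective mw′≡mw)
  ... | no mw∉m           = ⊥-elim (mw∉m (w , refl))

  g-rest : ∀ j → g (rest j) ≡ inj₂ j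
  g-rest j with m? (rest j)
  ... | yes restj∈m = ⊥-elim (embed-∈ j restj∈m)
  ... | no restj∉m  = cong inj₂ (rest-injective (proj₂ (embed-covers (rest j) restj∉m)))

  isSetPushout : IsSetPushout m f g inj₁
  isSetPushout = record
    { commute            = g-m
    ; jointly-surjective = λ { (inj₁ y) → inj₂ (y , refl) ; (inj₂ j) → inj₁ (rest j , g-rest j) }
    ; n-injective        = inj₁-injective
    ; glued              = glued
    ; g-injective-off-m  = g-injective-off-m
    }
    where
      glued : ∀ x y → g x ≡ inj₁ y → Σ (Fin z) λ w → m w ≡ x × f w ≡ y
      glued x y gx≡y with image-or-rest x
      ... | inj₁ (w , refl) = w , refl , inj₁-injective (trans (sym (g-m w)) gx≡y)
      ... | inj₂ (j , refl) with trans (sym (g-rest j)) gx≡y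
      ...   | ()

      g-injective-off-m : ∀ {x x′} → g x ≡ g x′ → x ≡ x′ ⊎ fiber m x
      g-injective-off-m {x} {x′} gx≡gx′ with image-or-rest x | image-or-rest x′
      ... | inj₁ x∈m        | _               = inj₂ x∈m
      ... | inj₂ (j , refl) | inj₁ (w , refl) with trans (sym (g-rest j)) (trans gx≡gx′ (g-m w))
      ...   | ()
      g-injective-off-m gx≡gx′ | inj₂ (j , refl) | inj₂ (j′ , refl) =
        inj₁ (cong rest (inj₂-injective (trans (sym (g-rest j)) (trans gx≡gx′ (g-rest j′)))))

module CanonicalPushout {Z A B : Graph} (m : GraphHom Z A) (mM : Mᵤ m) (f : GraphHom Z B) where
  private
    module Pᴱ = ComplementPushout (φE m) (proj₁ mM) (φE f)
    module Pⱽ = ComplementPushout (φV m) (proj₂ mM) (φV f)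

    joinⱽ = join (nV B) Pⱽ.r
    joinᴱ = join (nE B) Pᴱ.r

    edge-ends : Fin (nE B) ⊎ Fin Pᴱ.r → UPair (Fin (nV B + Pⱽ.r))
    edge-ends (inj₁ y) = P12 (joinⱽ ∘′ inj₁) (inc B y)
    edge-ends (inj₂ j) = P12 (joinⱽ ∘′ Pⱽ.g) (inc A (Pᴱ.rest j))

  Q : Graph
  Q = record { nE = nE B + Pᴱ.r ; nV = nV B + Pⱽ.r ; inc = edge-ends ∘′ splitAt (nE B) }

  private
    inc-join : ∀ q → inc Q (joinᴱ q) ≡ edge-ends q
    inc-join q = cong edge-ends (splitAt-join (nE B) Pᴱ.r q)

  n : GraphHom B Q
  n = record { φE = joinᴱ ∘′ inj₁ ; φV = joinⱽ ∘′ inj₁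
             ; comm = λ y → ≡⇒≈ᵤ (inc-join (inj₁ y)) }

  g : GraphHom A Q
  g = record { φE = joinᴱ ∘′ Pᴱ.g ; φV = joinⱽ ∘′ Pⱽ.g ; comm = g-comm }
    where
      open SetoidReasoning (≈ᵤ-setoid (Fin (nV Q)))
      Commutes-at : Fin (nE A) → Set
      Commutes-at x = inc Q (joinᴱ (Pᴱ.g x)) ≈ᵤ P12 (joinⱽ ∘′ Pⱽ.g) (inc A x)
      on-image : ∀ w → Commutes-at (φE m w)
      on-image w = begin
        inc Q (joinᴱ (Pᴱ.g (φE m w)))
          ≡⟨ cong (inc Q ∘′ joinᴱ) (Pᴱ.g-m w) ⟩
        inc Q (joinᴱ (inj₁ (φE f w)))
          ≈⟨ comm n (φE f w) ⟩
        P12 (joinⱽ ∘′ inj₁) (inc B (φE f w))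
          ≈⟨ P12-cong (joinⱽ ∘′ inj₁) (comm f w) ⟩
        P12 (joinⱽ ∘′ inj₁ ∘′ φV f) (inc Z w)
          ≡⟨ P12-≗ (λ v → cong joinⱽ (Pⱽ.g-m v)) (inc Z w) ⟨
        P12 (joinⱽ ∘′ Pⱽ.g) (P12 (φV m) (inc Z w))
          ≈⟨ P12-cong (joinⱽ ∘′ Pⱽ.g) (comm m w) ⟨
        P12 (joinⱽ ∘′ Pⱽ.g) (inc A (φE m w))
          ∎
      on-rest : ∀ j → Commutes-at (Pᴱ.rest j)
      on-rest j = ≡⇒≈ᵤ (trans (cong (inc Q ∘′ joinᴱ) (Pᴱ.g-rest j)) (inc-join (inj₂ j)))
      g-comm : ∀ x → Commutes-at x
      g-comm x with Pᴱ.image-or-rest x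
      ... | inj₁ (w , refl) = on-image w
      ... | inj₂ (j , refl) = on-rest j

  private
    transported : ∀ {b r} {Z A : Set} {m : Z → A} {f : Z → Fin b} {g : A → Fin b ⊎ Fin r} →
                  IsSetPushout m f g inj₁ → IsSetPushout m f (join b r ∘′ g) (join b r ∘′ inj₁)
    transported {b} {r} po = IsSetPushout-transport po (join b r) (splitAt b)
      (join-splitAt b r) (splitAt-join b r) (λ _ → refl) (λ _ → refl)

  set-pushoutᴱ : IsSetPushout (φE m) (φE f) (φE g) (φE n)
  set-pushoutᴱ = transported Pᴱ.isSetPushout

  set-pushoutⱽ : IsSetPushout (φV m) (φV f) (φV g) (φV n)
  set-pushoutⱽ = transported Pⱽ.isSetPushout

  isPushout : IsPushout m f g n
  isPushout = set-pushouts⇒pushout set-pushoutᴱ set-pushoutⱽ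

pushout⇒set-pushouts : ∀ {Z A B Q} {m : GraphHom Z A} {f : GraphHom Z B}
                       {g : GraphHom A Q} {n : GraphHom B Q} → IsPushout m f g n → Mᵤ m →
                       IsSetPushout (φE m) (φE f) (φE g) (φE n) ×
                       IsSetPushout (φV m) (φV f) (φV g) (φV n)
pushout⇒set-pushouts {m = m} {f} po mM
  with pushout-unique (CanonicalPushout.isPushout m mM f) po
... | u , v , (uvᴱ , uvⱽ) , (vuᴱ , vuⱽ) , (ugᴱ , ugⱽ) , (unᴱ , unⱽ) =
    IsSetPushout-transport set-pushoutᴱ (φE u) (φE v) uvᴱ vuᴱ ugᴱ unᴱ
  , IsSetPushout-transport set-pushoutⱽ (φV u) (φV v) uvⱽ vuⱽ ugⱽ unⱽ
  where
    open CanonicalPushout m mM f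

-- The van Kampen property

-- Bottom face m f g n, top face m′ f′ g′ n′, vertical maps a b c d (over A B C D);
-- □k is the side face standing on the bottom edge k.
module SetVanKampen
  {A B C D A′ B′ C′ D′ : Set}
  {m : A → B} {f : A → C} {g : B → D} {n : C → D}
  {m′ : A′ → B′} {f′ : A′ → C′} {g′ : B′ → D′} {n′ : C′ → D′}
  {a : A′ → A} {b : B′ → B} {c : C′ → C} {d : D′ → D}
  (m-injective : Inj m) (b-injective : Inj b) (c-injective : Inj c)
  (bottom : IsSetPushout m f g n) (top-commutes : ∀ x → g′ (m′ x) ≡ n′ (f′ x))
  (□m : ∀ x → m (a x) ≡ b (m′ x)) (□f : ∀ x → f (a x) ≡ c (f′ x))
  (□g : ∀ x → g (b x) ≡ d (g′ x)) (□n : ∀ x → n (c x) ≡ d (n′ x))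
  (back-m : IsSetPullback m′ a b m) (back-f : IsSetPullback f′ a c f)
  where
  private
    module Bottom = IsSetPushout bottom
    module Back-m = IsSetPullback back-m
    module Back-f = IsSetPullback back-f

  m′-injective : Inj m′
  m′-injective {x} {y} m′x≡m′y = Back-m.jointly-injective m′x≡m′y
    (m-injective (trans (□m x) (trans (cong b m′x≡m′y) (sym (□m y)))))

  module _ (top : IsSetPushout m′ f′ g′ n′) where
    private module Top = IsSetPushout top

    g′-preimage-of-n′ : ∀ x′ γ′ → n′ γ′ ≡ x′ → ∀ β → d x′ ≡ g β →
                        Σ B′ λ β′ → g′ β′ ≡ x′ × b β′ ≡ β
    g′-preimage-of-n′ x′ γ′ n′γ′≡x′ β dx′≡gβ
      with Bottom.glued β (c γ′)
             (trans (sym dx′≡gβ) (trans (cong d (sym n′γ′≡x′)) (sym (□n γ′))))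
    ... | α , mα≡β , fα≡cγ′ with Back-f.complete γ′ α (sym fα≡cγ′)
    ... | α′ , f′α′≡γ′ , aα′≡α =
      m′ α′ , trans (top-commutes α′) (trans (cong n′ f′α′≡γ′) n′γ′≡x′)
            , trans (sym (□m α′)) (trans (cong m aα′≡α) mα≡β)

    front-g : IsSetPullback g′ b d g
    front-g = record
      { commute = λ x → sym (□g x) ; jointly-injective = λ _ b≡ → b-injective b≡
      ; complete = complete }
      where
        complete : ∀ x′ β → d x′ ≡ g β → Σ B′ λ β′ → g′ β′ ≡ x′ × b β′ ≡ β
        complete x′ β dx′≡gβ with Top.jointly-surjective x′
        ... | inj₂ (γ′ , n′γ′≡x′) = g′-preimage-of-n′ x′ γ′ n′γ′≡x′ β dx′≡gβ
        ... | inj₁ (β″ , g′β″≡x′)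
          with Bottom.g-injective-off-m (trans (□g β″) (trans (cong d g′β″≡x′) dx′≡gβ))
        ...   | inj₁ bβ″≡β = β″ , g′β″≡x′ , bβ″≡β
        ...   | inj₂ (α , mα≡bβ″) with Back-m.complete β″ α (sym mα≡bβ″)
        ...     | α″ , m′α″≡β″ , _ =
          g′-preimage-of-n′ x′ (f′ α″)
            (trans (sym (top-commutes α″)) (trans (cong g′ m′α″≡β″) g′β″≡x′))
            β dx′≡gβ

    front-n : IsSetPullback n′ c d n
    front-n = record
      { commute = λ x → sym (□n x) ; jointly-injective = λ _ c≡ → c-injective c≡
      ; complete = complete }
      where
        complete : ∀ x′ γ → d x′ ≡ n γ → Σ C′ λ γ′ → n′ γ′ ≡ x′ × c γ′ ≡ γ
        complete x′ γ dx′≡nγ with Top.jointly-surjective x′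
        ... | inj₂ (γ″ , n′γ″≡x′) =
          γ″ , n′γ″≡x′ , Bottom.n-injective (trans (□n γ″) (trans (cong d n′γ″≡x′) dx′≡nγ))
        ... | inj₁ (β′ , g′β′≡x′)
          with Bottom.glued (b β′) γ (trans (□g β′) (trans (cong d g′β′≡x′) dx′≡nγ))
        ...   | α , mα≡bβ′ , fα≡γ with Back-m.complete β′ α (sym mα≡bβ′)
        ...     | α′ , m′α′≡β′ , aα′≡α =
          f′ α′ , trans (sym (top-commutes α′)) (trans (cong g′ m′α′≡β′) g′β′≡x′)
                , trans (sym (□f α′)) (trans (cong f aα′≡α) fα≡γ)

  front-pullbacks⇒top-pushout : IsSetPullback g′ b d g → IsSetPullback n′ c d n →
                                IsSetPushout m′ f′ g′ n′
  front-pullbacks⇒top-pushout front-g front-n = record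
    { commute            = top-commutes
    ; jointly-surjective = jointly-surjective
    ; n-injective        = λ {γ₁} {γ₂} n′γ₁≡n′γ₂ →
        c-injective (Bottom.n-injective
          (trans (□n γ₁) (trans (cong d n′γ₁≡n′γ₂) (sym (□n γ₂)))))
    ; glued              = glued
    ; g-injective-off-m  = g-injective-off-m
    }
    where
      module Front-g = IsSetPullback front-g
      module Front-n = IsSetPullback front-n

      jointly-surjective : ∀ x′ → fiber g′ x′ ⊎ fiber n′ x′
      jointly-surjective x′ with Bottom.jointly-surjective (d x′)
      ... | inj₁ (β , gβ≡dx′) =
        let (β′ , g′β′≡x′ , _) = Front-g.complete x′ β (sym gβ≡dx′) in inj₁ (β′ , g′β′≡x′)
      ... | inj₂ (γ , nγ≡dx′) =
        let (γ′ , n′γ′≡x′ , _) = Front-n.complete x′ γ (sym nγ≡dx′) in inj₂ (γ′ , n′γ′≡x′)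

      glued : ∀ β′ γ′ → g′ β′ ≡ n′ γ′ → Σ A′ λ α′ → m′ α′ ≡ β′ × f′ α′ ≡ γ′
      glued β′ γ′ g′β′≡n′γ′
        with Bottom.glued (b β′) (c γ′)
               (trans (□g β′) (trans (cong d g′β′≡n′γ′) (sym (□n γ′))))
      ... | α , mα≡bβ′ , fα≡cγ′ with Back-m.complete β′ α (sym mα≡bβ′)
      ... | α′ , m′α′≡β′ , aα′≡α =
        α′ , m′α′≡β′ , c-injective (trans (sym (□f α′)) (trans (cong f aα′≡α) fα≡cγ′))

      g-injective-off-m : ∀ {β₁ β₂} → g′ β₁ ≡ g′ β₂ → β₁ ≡ β₂ ⊎ fiber m′ β₁
      g-injective-off-m {β₁} {β₂} g′β₁≡g′β₂
        with Bottom.g-injective-off-m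
               (trans (□g β₁) (trans (cong d g′β₁≡g′β₂) (sym (□g β₂))))
      ... | inj₁ bβ₁≡bβ₂    = inj₁ (b-injective bβ₁≡bβ₂)
      ... | inj₂ (α , mα≡bβ₁) =
        let (α′ , m′α′≡β₁ , _) = Back-m.complete β₁ α (sym mα≡bβ₁) in inj₂ (α′ , m′α′≡β₁)

pullback⇒set-pullbacks : ∀ {P A B Z} {p₁ : GraphHom P A} {p₂ : GraphHom P B}
                         {f : GraphHom A Z} {g : GraphHom B Z} → IsPullback p₁ p₂ f g →
                         Inj (φV f) ⊎ Inj (φV g) →
                         IsSetPullback (φE p₁) (φE p₂) (φE f) (φE g) ×
                         IsSetPullback (φV p₁) (φV p₂) (φV f) (φV g)
pullback⇒set-pullbacks pb (inj₁ fⱽ-injective) =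
  IsSetPullback-sym (PullbackComponents.edge-pullback (IsPullback-sym pb) fⱽ-injective)
  , PullbackComponents.vertex-pullback pb
pullback⇒set-pullbacks pb (inj₂ gⱽ-injective) =
  PullbackComponents.edge-pullback pb gⱽ-injective , PullbackComponents.vertex-pullback pb

van-Kampen : ∀ {A B C D} (m : GraphHom A B) (f : GraphHom A C) (g : GraphHom B D) (n : GraphHom C D) →
             Mᵤ m → IsPushout m f g n → IsMVanKampen m f g n
van-Kampen m f g n mM bottom m′ f′ g′ n′ a b c d
           (topᴱ , topⱽ) (□mᴱ , □mⱽ) (□fᴱ , □fⱽ) (□gᴱ , □gⱽ) (□nᴱ , □nⱽ) bM cM dM back-m back-f =
  top⇒front , front⇒top
  where
    bottom-sets = pushout⇒set-pushouts bottom mM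
    back-m-sets = pullback⇒set-pullbacks back-m (inj₂ (proj₂ mM))
    back-f-sets = pullback⇒set-pullbacks back-f (inj₁ (proj₂ cM))
    module VKᴱ = SetVanKampen {g′ = φE g′} {n′ = φE n′} {d = φE d}
                              (proj₁ mM) (proj₁ bM) (proj₁ cM) (proj₁ bottom-sets) topᴱ □mᴱ □fᴱ □gᴱ □nᴱ
                              (proj₁ back-m-sets) (proj₁ back-f-sets)
    module VKⱽ = SetVanKampen {g′ = φV g′} {n′ = φV n′} {d = φV d}
                              (proj₂ mM) (proj₂ bM) (proj₂ cM) (proj₂ bottom-sets) topⱽ □mⱽ □fⱽ □gⱽ □nⱽ
                              (proj₂ back-m-sets) (proj₂ back-f-sets)

    top⇒front : IsPushout m′ f′ g′ n′ → IsPullback g′ b d g × IsPullback n′ c d n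
    top⇒front top =
      let (topᴱ-po , topⱽ-po) = pushout⇒set-pushouts top (VKᴱ.m′-injective , VKⱽ.m′-injective)
      in set-pullbacks⇒pullback (VKᴱ.front-g topᴱ-po) (VKⱽ.front-g topⱽ-po) (inj₂ (proj₂ bM))
       , set-pullbacks⇒pullback (VKᴱ.front-n topᴱ-po) (VKⱽ.front-n topⱽ-po) (inj₂ (proj₂ cM))

    front⇒top : IsPullback g′ b d g × IsPullback n′ c d n → IsPushout m′ f′ g′ n′
    front⇒top (front-g , front-n) =
      let (front-gᴱ , front-gⱽ) = pullback⇒set-pullbacks front-g (inj₁ (proj₂ dM))
          (front-nᴱ , front-nⱽ) = pullback⇒set-pullbacks front-n (inj₁ (proj₂ dM))
      in set-pushouts⇒pushout (VKᴱ.front-pullbacks⇒top-pushout front-gᴱ front-nᴱ)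
                              (VKⱽ.front-pullbacks⇒top-pushout front-gⱽ front-nⱽ)

uGraph-M-adhesive : IsMAdhesive
uGraph-M-adhesive = record
  { M-mono      = Mᵤ-mono
  ; M-isos      = iso⇒injective
  ; M-comp      = λ _ _ (fᴱ-injective , fⱽ-injective) (gᴱ-injective , gⱽ-injective) →
                    fᴱ-injective ∘′ gᴱ-injective , fⱽ-injective ∘′ gⱽ-injective
  ; M-pushout   = λ _ _ _ _ po mM → let (poᴱ , poⱽ) = pushout⇒set-pushouts po mM in
                    IsSetPushout.n-injective poᴱ , IsSetPushout.n-injective poⱽ
  ; M-pullback  = λ _ _ _ _ pb (mᴱ-injective , mⱽ-injective) →
                    let (pbᴱ , pbⱽ) = pullback⇒set-pullbacks pb (inj₂ mⱽ-injective) in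
                    IsSetPullback.p₁-injective pbᴱ mᴱ-injective
                  , IsSetPullback.p₁-injective pbⱽ mⱽ-injective
  ; pushouts    = λ m f mM → let open CanonicalPushout m mM f in Q , g , n , isPushout
  ; pullbacks   = λ f m mM → let open CanonicalPullback f m mM in graph , ι , p₂ , pullback
  ; van-Kampen  = λ m f g n mM po → van-Kampen m f g n mM po
  }

-- Initial object and effective unions

empty : Graph
empty = record { nE = 0 ; nV = 0 ; inc = λ () }

empty-M-initial : IsMInitial empty
empty-M-initial X =
    record { φE = λ () ; φV = λ () ; comm = λ () }
  , ((λ { {()} }) , (λ { {()} }))
  , λ _ _ → (λ ()) , (λ ())

module _ {A B C Q E : Set} {m₁ : A → B} {m₂ : A → C} {n₁ : B → Q} {n₂ : C → Q}
         {e₁ : B → E} {e₂ : C → E}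
         (po : IsSetPushout m₁ m₂ n₁ n₂) (pb : IsSetPullback m₁ m₂ e₁ e₂) where

  glue-along-pullback : ∀ b c → e₁ b ≡ e₂ c → n₁ b ≡ n₂ c
  glue-along-pullback b c e₁b≡e₂c =
    let (a , m₁a≡b , m₂a≡c) = IsSetPullback.complete pb b c e₁b≡e₂c
    in trans (cong n₁ (sym m₁a≡b)) (trans (IsSetPushout.commute po a) (cong n₂ m₂a≡c))

  set-effective-union : Inj e₁ → Inj e₂ → (u : Q → E) →
                        (∀ b → u (n₁ b) ≡ e₁ b) → (∀ c → u (n₂ c) ≡ e₂ c) → Inj u
  set-effective-union e₁-injective e₂-injective u un₁≗e₁ un₂≗e₂ {q} {q′} uq≡uq′
    with IsSetPushout.jointly-surjective po q | IsSetPushout.jointly-surjective po q′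
  ... | inj₁ (b , refl) | inj₁ (b′ , refl) =
    cong n₁ (e₁-injective (trans (sym (un₁≗e₁ b)) (trans uq≡uq′ (un₁≗e₁ b′))))
  ... | inj₁ (b , refl) | inj₂ (c , refl) =
    glue-along-pullback b c (trans (sym (un₁≗e₁ b)) (trans uq≡uq′ (un₂≗e₂ c)))
  ... | inj₂ (c , refl) | inj₁ (b , refl) =
    sym (glue-along-pullback b c (trans (sym (un₁≗e₁ b)) (trans (sym uq≡uq′) (un₂≗e₂ c))))
  ... | inj₂ (c , refl) | inj₂ (c′ , refl) =
    cong n₂ (e₂-injective (trans (sym (un₂≗e₂ c)) (trans uq≡uq′ (un₂≗e₂ c′))))

effective-unions : HasMEffectiveUnions
effective-unions m₁ m₂ n₁ n₂ e₁ e₂ m₁M _ _ _ (e₁ᴱ-injective , e₁ⱽ-injective) e₂M po pb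
                 u (un₁ᴱ , un₁ⱽ) (un₂ᴱ , un₂ⱽ) =
    set-effective-union poᴱ pbᴱ e₁ᴱ-injective (proj₁ e₂M) (φE u) un₁ᴱ un₂ᴱ
  , set-effective-union poⱽ pbⱽ e₁ⱽ-injective (proj₂ e₂M) (φV u) un₁ⱽ un₂ⱽ
  where
    poᴱ = proj₁ (pushout⇒set-pushouts po m₁M)
    poⱽ = proj₂ (pushout⇒set-pushouts po m₁M)
    pbᴱ = proj₁ (pullback⇒set-pullbacks pb (inj₂ (proj₂ e₂M)))
    pbⱽ = proj₂ (pullback⇒set-pullbacks pb (inj₂ (proj₂ e₂M)))

-- Epi-M factorisation

image-indicator : ∀ {n k} → (Fin n → Fin k) → Fin k → Fin 2
image-indicator f y with any? (λ x → f x ≟ y)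
... | yes _ = zero
... | no _  = suc zero

image-indicator-image : ∀ {n k} (f : Fin n → Fin k) x → image-indicator f (f x) ≡ zero
image-indicator-image f x with any? (λ x′ → f x′ ≟ f x)
... | yes _  = refl
... | no fx∉ = ⊥-elim (fx∉ (x , refl))

image-indicator-zero : ∀ {n k} (f : Fin n → Fin k) y → image-indicator f y ≡ zero → fiber f y
image-indicator-zero f y χ≡0 with any? (λ x → f x ≟ y)
... | yes y∈ = y∈
image-indicator-zero f y () | no _

loopedK₂ : Graph
loopedK₂ = record { nE = 3 ; nV = 2 ; inc = ends }
  where
    ends : Fin 3 → UPair (Fin 2)
    ends zero          = zero , zero
    ends (suc zero)    = zero , suc zero
    ends (suc (suc _)) = suc zero , suc zero

loopedK₂-edge : Fin 2 → Fin 2 → Fin 3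
loopedK₂-edge zero    zero    = zero
loopedK₂-edge zero    (suc _) = suc zero
loopedK₂-edge (suc _) zero    = suc zero
loopedK₂-edge (suc _) (suc _) = suc (suc zero)

loopedK₂-edge-ends : ∀ s t → inc loopedK₂ (loopedK₂-edge s t) ≈ᵤ (s , t)
loopedK₂-edge-ends zero       zero       = ≈ᵤ-refl
loopedK₂-edge-ends zero       (suc zero) = ≈ᵤ-refl
loopedK₂-edge-ends (suc zero) zero       = inj₂ (refl , refl)
loopedK₂-edge-ends (suc zero) (suc zero) = ≈ᵤ-refl

vertex-colouring : ∀ (G : Graph) → (Fin (nV G) → Fin 2) → GraphHom G loopedK₂
vertex-colouring G χ = record
  { φE = λ e → loopedK₂-edge (χ (proj₁ (inc G e))) (χ (proj₂ (inc G e)))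
  ; φV = χ
  ; comm = λ e → loopedK₂-edge-ends _ _ }

twoLoops : Graph
twoLoops = record { nE = 2 ; nV = 1 ; inc = λ _ → zero , zero }

edge-colouring : ∀ (G : Graph) → (Fin (nE G) → Fin 2) → GraphHom G twoLoops
edge-colouring G χ = record { φE = χ ; φV = λ _ → zero ; comm = λ _ → ≈ᵤ-refl }

-- Each image indicator agrees with the constant colouring after e, hence everywhere.
epi⇒surjective : ∀ {A K} (e : GraphHom A K) → Epi e → Surjective e
epi⇒surjective {K = K} e epi = surjᴱ , surjⱽ
  where
    χᴱ = image-indicator (φE e)
    χⱽ = image-indicator (φV e)

    χⱽ-ends : ∀ x → Both (λ v → χⱽ v ≡ zero) (inc K (φE e x))
    χⱽ-ends x = Both-≈ᵤ-P12 {f = φV e} {P = λ v → χⱽ v ≡ zero} (image-indicator-image (φV e)) (comm e x)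

    vertex-colourings-agree : vertex-colouring K (λ _ → zero) ≈ₕ vertex-colouring K χⱽ
    vertex-colourings-agree = epi (vertex-colouring K (λ _ → zero)) (vertex-colouring K χⱽ)
      ( (λ x → let (χ₁ , χ₂) = χⱽ-ends x in cong₂ loopedK₂-edge (sym χ₁) (sym χ₂))
      , (λ v → sym (image-indicator-image (φV e) v)))

    edge-colourings-agree : edge-colouring K (λ _ → zero) ≈ₕ edge-colouring K χᴱ
    edge-colourings-agree = epi (edge-colouring K (λ _ → zero)) (edge-colouring K χᴱ)
      ((λ x → sym (image-indicator-image (φE e) x)) , (λ _ → refl))

    surjᴱ : ∀ x → fiber (φE e) x
    surjᴱ x = image-indicator-zero (φE e) x (sym (proj₁ edge-colourings-agree x))

    surjⱽ : ∀ v → fiber (φV e) v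
    surjⱽ v = image-indicator-zero (φV e) v (sym (proj₂ vertex-colourings-agree v))

surjective⇒epi : ∀ {A K} (e : GraphHom A K) → Surjective e → Epi e
surjective⇒epi e (surjᴱ , surjⱽ) g h (geᴱ≗heᴱ , geⱽ≗heⱽ) =
    (λ x → let (y , ey≡x) = surjᴱ x
           in trans (cong (φE g) (sym ey≡x)) (trans (geᴱ≗heᴱ y) (cong (φE h) ey≡x)))
  , (λ v → let (y , ey≡v) = surjⱽ v
           in trans (cong (φV g) (sym ey≡v)) (trans (geⱽ≗heⱽ y) (cong (φV h) ey≡v)))

epi-M-factorization : HasEpiMFactorization
epi-M-factorization {A} {B} f =
  graph , e , ι , surjective⇒epi e e-surjective , ι-M , ι∘e≈f , unique
  where
    closed : ∀ x → fiber (φE f) x → Both (fiber (φV f)) (inc B x)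
    closed x (a , refl) = endpoints-fiber (comm f a)
    open Subgraph (subgraph B {fiber (φE f)} {fiber (φV f)}
                     (λ x → any? (λ a → φE f a ≟ x)) (λ v → any? (λ a → φV f a ≟ v)) closed)
    factored = factor-through-ι f (λ a → a , refl) (λ v → v , refl)
    e = proj₁ factored
    ι∘e≈f = proj₂ factored
    e-surjective : Surjective e
    e-surjective = factor-surjective ι e f ι∘e≈f ι-M edge-∈ vertex-∈
    unique : ∀ {K′} (e′ : GraphHom A K′) (m′ : GraphHom K′ B) → Epi e′ → Mᵤ m′ → m′ ∘ₕ e′ ≈ₕ f →
             Σ (GraphHom graph K′) λ i → IsIso i × (i ∘ₕ e ≈ₕ e′) × (m′ ∘ₕ i ≈ₕ ι)
    unique e′ m′ e′-epi m′M m′e′≈f =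
      i , bijective⇒iso i i-injective i-surjective , ie≈e′ , m′i≈ι
      where
        factored′ = factor-through m′ (proj₂ m′M) ι
          (λ j → let (a , fa≡ιj) = edge-∈ j in φE e′ a , trans (proj₁ m′e′≈f a) fa≡ιj)
          (λ j → let (v , fv≡ιj) = vertex-∈ j in φV e′ v , trans (proj₂ m′e′≈f v) fv≡ιj)
        i = proj₁ factored′
        m′i≈ι = proj₂ factored′
        ie≈e′ : i ∘ₕ e ≈ₕ e′
        ie≈e′ = Mᵤ-mono m′ m′M (i ∘ₕ e) e′
          ( (λ a → trans (proj₁ m′i≈ι (φE e a))
                         (trans (proj₁ ι∘e≈f a) (sym (proj₁ m′e′≈f a))))
          , (λ v → trans (proj₂ m′i≈ι (φV e v))
                         (trans (proj₂ ι∘e≈f v) (sym (proj₂ m′e′≈f v)))))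
        i-injective = M-cancelʳ m′ i ι m′i≈ι ι-M
        i-surjective = Surjective-cancelʳ i e e′ ie≈e′ (epi⇒surjective e′ e′-epi)

-- Final pullback complements

-- The elements kept by the final pullback complement of α followed by β.
Survives : ∀ {X Y Z : Set} → (X → Y) → (Y → Z) → Z → Set
Survives α β z = ¬ fiber β z ⊎ fiber (β ∘′ α) z

survives? : ∀ {x y z} (α : Fin x → Fin y) (β : Fin y → Fin z) → Decidable (Survives α β)
survives? α β w = ¬? (any? (λ u → β u ≟ w)) ⊎-dec any? (λ u → β (α u) ≟ w)

survivors-pullback : ∀ {A B C D : Set} {a : A → B} {b : B → D} {ι : C → D} {d : A → C} →
                     Inj a → Inj b → Inj ι → (∀ x → ι (d x) ≡ b (a x)) →
                     (∀ y → Survives a b (ι y)) → IsSetPullback a d b ι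
survivors-pullback {a = a} {b} {ι} {d} a-injective b-injective ι-injective ιd≗ba survives = record
  { commute           = λ x → sym (ιd≗ba x)
  ; jointly-injective = λ a≡ _ → a-injective a≡
  ; complete          = complete
  }
  where
    complete : ∀ x y → b x ≡ ι y → Σ _ λ z → a z ≡ x × d z ≡ y
    complete x y bx≡ιy with survives y
    ... | inj₁ ιy∉b          = ⊥-elim (ιy∉b (x , bx≡ιy))
    ... | inj₂ (z , baz≡ιy) =
      z , b-injective (trans baz≡ιy (sym bx≡ιy)) , ι-injective (trans (ιd≗ba z) baz≡ιy)

pullback-survives : ∀ {X Y A B D : Set} {a : A → B} {b : B → D}
                    {p : X → A} {q : X → Y} {r : Y → D} →
                    IsSetPullback (a ∘′ p) q b r → (∀ w → Dec (fiber b w)) →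
                    ∀ y → Survives a b (r y)
pullback-survives {b = b} {p} pb b? y with b? _
... | no ry∉b          = inj₁ ry∉b
... | yes (x , bx≡ry) =
  let (z , apz≡x , _) = IsSetPullback.complete pb x y bx≡ry in inj₂ (p z , trans (cong b apz≡x) bx≡ry)

module CanonicalFPC {A B D : Graph} (a : GraphHom A B) (b : GraphHom B D) (aM : Mᵤ a) (bM : Mᵤ b) where
  private
    Survivesⱽ = Survives (φV a) (φV b)
    Survivesᴱ : Fin (nE D) → Set
    Survivesᴱ x = Survives (φE a) (φE b) x × Both Survivesⱽ (inc D x)

  open Subgraph (subgraph D {Survivesᴱ} {Survivesⱽ}
                   (λ x → survives? (φE a) (φE b) x
                            ×-dec (survives? (φV a) (φV b) _ ×-dec survives? (φV a) (φV b) _))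
                   (survives? (φV a) (φV b)) (λ _ → proj₂)) public

  factor-survivors : ∀ {X} (h : GraphHom X D) →
                     (∀ e → Survives (φE a) (φE b) (φE h e)) → (∀ v → Survivesⱽ (φV h v)) →
                     Σ (GraphHom X graph) λ s → ι ∘ₕ s ≈ₕ h
  factor-survivors h hᴱ hⱽ = factor-through-ι h
    (λ e → hᴱ e , Both-≈ᵤ-P12 {f = φV h} {P = Survivesⱽ} hⱽ (comm h e)) hⱽ

  private
    factored-b∘a = factor-survivors (b ∘ₕ a) (λ x → inj₂ (x , refl)) (λ v → inj₂ (v , refl))

  d : GraphHom A graph
  d = proj₁ factored-b∘a

  ι∘d≈b∘a : ι ∘ₕ d ≈ₕ b ∘ₕ a
  ι∘d≈b∘a = proj₂ factored-b∘a

  pullback : IsPullback a d b ι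
  pullback = set-pullbacks⇒pullback
    (survivors-pullback (proj₁ aM) (proj₁ bM) (proj₁ ι-M) (proj₁ ι∘d≈b∘a) (λ y → proj₁ (edge-∈ y)))
    (survivors-pullback (proj₂ aM) (proj₂ bM) (proj₂ ι-M) (proj₂ ι∘d≈b∘a) vertex-∈)
    (inj₁ (proj₂ aM))

  isFPC : IsFPC a b d ι
  isFPC = pullback , final
    where
      final : ∀ {X Y} (p : GraphHom X A) (q : GraphHom X Y) (r : GraphHom Y D) →
              IsPullback (a ∘ₕ p) q b r →
              Σ (GraphHom Y graph) λ s → (ι ∘ₕ s ≈ₕ r) × (s ∘ₕ q ≈ₕ d ∘ₕ p) ×
                (∀ s′ → ι ∘ₕ s′ ≈ₕ r → s′ ∘ₕ q ≈ₕ d ∘ₕ p → s′ ≈ₕ s)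
      final p q r r-pullback =
        s , ιs≈r
          , Mᵤ-mono ι ι-M (s ∘ₕ q) (d ∘ₕ p)
              ( (λ x → trans (proj₁ ιs≈r (φE q x))
                             (trans (sym (proj₁ square x)) (sym (proj₁ ι∘d≈b∘a (φE p x)))))
              , (λ v → trans (proj₂ ιs≈r (φV q v))
                             (trans (sym (proj₂ square v)) (sym (proj₂ ι∘d≈b∘a (φV p v))))))
          , λ s′ (ιs′ᴱ≗r , ιs′ⱽ≗r) _ → Mᵤ-mono ι ι-M s′ s
              ( (λ y → trans (ιs′ᴱ≗r y) (sym (proj₁ ιs≈r y)))
              , (λ y → trans (ιs′ⱽ≗r y) (sym (proj₂ ιs≈r y))))
        where
          open IsPullback r-pullback renaming (commutes to square)
          r-sets = pullback⇒set-pullbacks r-pullback (inj₁ (proj₂ bM))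
          factored = factor-survivors r
            (pullback-survives (proj₁ r-sets) (λ w → any? (λ u → φE b u ≟ w)))
            (pullback-survives (proj₂ r-sets) (λ w → any? (λ u → φV b u ≟ w)))
          s = proj₁ factored
          ιs≈r = proj₂ factored

FPCs-along-M : HasFPCsAlongM
FPCs-along-M a b aM bM = graph , d , ι , isFPC
  where open CanonicalFPC a b aM bM

M-stable-under-FPC : MStableUnderFPC
M-stable-under-FPC a b d c aM bM fpc with FPC-unique fpc (CanonicalFPC.isFPC a b aM bM)
... | s , s-iso , ιs≈c =
    M-pullback d a c b (IsPullback-sym (proj₁ fpc)) bM
  , Mᵤ-resp-≈ (ι ∘ₕ s) c ιs≈c (M-comp s ι (M-isos s s-iso) ι-M)
  where
    open IsMAdhesive uGraph-M-adhesive
    open CanonicalFPC a b aM bM using (ι; ι-M)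

-- Finitely many subobjects

-- An M-subobject of X is determined up to isomorphism by its image, a selection of edges
-- and vertices (zero marks the selected ones); finToFun enumerates all selections.
module Subobjects (X : Graph) where

  Selection : Set
  Selection = Fin (nE X + nV X) → Fin 2

  Selectedⱽ : Selection → Fin (nV X) → Set
  Selectedⱽ χ v = χ (join (nE X) (nV X) (inj₂ v)) ≡ zero

  Selectedᴱ : Selection → Fin (nE X) → Set
  Selectedᴱ χ e = χ (join (nE X) (nV X) (inj₁ e)) ≡ zero × Both (Selectedⱽ χ) (inc X e)

  Index : Set
  Index = Fin (2 ^ (nE X + nV X))

  selection : Index → Selection
  selection = finToFun

  subobject : (i : Index) → Subgraph X (Selectedᴱ (selection i)) (Selectedⱽ (selection i))
  subobject i = subgraph X (λ e → (χ _ ≟ zero) ×-dec ((χ _ ≟ zero) ×-dec (χ _ ≟ zero)))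
                           (λ v → χ _ ≟ zero) (λ _ → proj₂)
    where χ = selection i

  image-selection : ∀ {Y} → GraphHom Y X → Selection
  image-selection m = [ image-indicator (φE m) , image-indicator (φV m) ]′ ∘′ splitAt (nE X)

  module _ {Y : Graph} (m : GraphHom Y X) (mM : Mᵤ m) where
    private
      i = funToFin (image-selection m)
      open Subgraph (subobject i)

      selection-join : ∀ x → selection i (join (nE X) (nV X) x)
                             ≡ [ image-indicator (φE m) , image-indicator (φV m) ]′ x
      selection-join x = trans (finToFun-funToFin (image-selection m) _)
        (cong [ image-indicator (φE m) , image-indicator (φV m) ]′ (splitAt-join (nE X) (nV X) x))

      image-selectedⱽ : ∀ v → Selectedⱽ (selection i) (φV m v)
      image-selectedⱽ v = trans (selection-join (inj₂ (φV m v))) (image-indicator-image (φV m) v)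

      image-selectedᴱ : ∀ e → Selectedᴱ (selection i) (φE m e)
      image-selectedᴱ e =
          trans (selection-join (inj₁ (φE m e))) (image-indicator-image (φE m) e)
        , Both-≈ᵤ-P12 {f = φV m} {P = Selectedⱽ (selection i)} image-selectedⱽ (comm m e)

      factored = factor-through-ι m image-selectedᴱ image-selectedⱽ
      h = proj₁ factored
      ι∘h≈m = proj₂ factored

      h-surjective : Surjective h
      h-surjective = factor-surjective ι h m ι∘h≈m ι-M
        (λ x → image-indicator-zero (φE m) _ (trans (sym (selection-join (inj₁ (φE ι x)))) (proj₁ (edge-∈ x))))
        (λ v → image-indicator-zero (φV m) _ (trans (sym (selection-join (inj₂ (φV ι v)))) (vertex-∈ v)))

    M-subobject-index : Σ Index λ i → Σ (GraphHom Y (Subgraph.graph (subobject i))) λ h →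
                          IsIso h × (Subgraph.ι (subobject i) ∘ₕ h ≈ₕ m)
    M-subobject-index = i , h , bijective⇒iso h (M-cancelʳ ι h m ι∘h≈m mM) h-surjective , ι∘h≈m

finitary : IsFinitary
finitary X = 2 ^ (nE X + nV X) , (λ i → graph (subobject i)) , (λ i → ι (subobject i))
           , (λ i → ι-M (subobject i)) , M-subobject-index
  where
    open Subobjects X
    open Subgraph

mainTheorem1 : IsMAdhesive × IsFinitary × HasMInitial × HasMEffectiveUnions
               × HasEpiMFactorization × HasFPCsAlongM × MStableUnderFPC
mainTheorem1 = uGraph-M-adhesive , finitary , (empty , empty-M-initial) , effective-unions
             , epi-M-factorization , FPCs-along-M , M-stable-under-FPC
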